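{- Let $A_\bullet$ be a graded-commutative quadratic $\mathbb{F}_2$-algebra with space of generators $V=\mathrm{span}_{\mathbb{F}_2}\{t,a_1,\dots,a_d\}$ and space of relators $\Omega\subseteq V\otimes V$. Let $J=\{1,\dots,m\}$ and let $\{x_j: j\in J\}$ be distinct symbols not in $A$. Suppose $\{t,a_1,\dots,a_d\}$ is a set of PBW generators of $A_\bullet$ with respect to the degree-lexicographic order associated to $t\prec a_1\prec\dots\prec a_d$. Then $\{t,a_1,\dots,a_d,x_1,\dots,x_m\}$ is a set of PBW generators of the twisted extension $A[J;t]_\bullet$ with respect to the degree-lexicographic order associated to $t\prec a_1\prec\dots\prec a_d\prec x_1\prec\dots\prec x_m$.
   Context: The twisted extension $A[J;t]_\bullet$ is the quadratic $\mathbb{F}_2$-algebra with space of generators $\mathrm{span}\{t,a_1,\dots,a_d,x_j : j\in J\}$ and space of relators spanned by $\Omega$ together with $x_ix_j+x_jx_i$, $x_jt+tx_j$, $x_ja_k+a_kx_j$, $x_j^2-tx_j$ for $i,j\in J$, $k=1,\dots,d$. Degree-lexicographic order: monomials are compared first by degree, then lexicographically from the left using the given order on generators. For a quadratic algebra $T_\bullet(V)/(\Omega)$ with ordered basis of $V$ and admissible order: choose a normalized basis of $\Omega$ (each leading monomial has coefficient 1 and does not appear in other basis elements), regard each relation as a rewriting rule replacing its leading monomial by the remaining terms; a degree-3 monomial $x_ax_bx_c$ is critical if $x_ax_b$ and $x_bx_c$ are both leading monomials, and confluent if all rewriting sequences reach the same normal form. The ordered basis is a set of PBW generators (for the order) if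 every critical monomial is confluent. -}

module Defs where

open import Data.Bool using (Bool; true; false; _∧_; _xor_)
open import Data.Nat using (ℕ; suc; _+_)
open import Data.Fin using (Fin; toℕ; splitAt; _↑ˡ_; _↑ʳ_; zero; _≟_)
open import Data.Sum using (inj₁; inj₂)
open import Data.Product using (Σ; ∃; _×_; _,_)
open import Data.List using (List; length; lookup; map; concatMap; _++_)
open import Data.List using () renaming (allFin to allFinL)
open import Relation.Nullary using (¬_)
open import Relation.Nullary.Decidable using (⌊_⌋)
open import Relation.Binary.PropositionalEquality using (_≡_; _≢_)
open import Relation.Binary.Construct.Closure.ReflexiveTransitive using (Star)
import Data.Nat as ℕ

-- Generators are indexed by Fin n; the generator order is the order of Fin n.
-- Elements of V ⊗ V over F₂ : coefficient functions on degree-2 monomials.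
Tensor : ℕ → Set
Tensor n = Fin n → Fin n → Bool

Cube : ℕ → Set
Cube n = Fin n → Fin n → Fin n → Bool

_≟ᵇ_ : ∀ {n} → Fin n → Fin n → Bool
x ≟ᵇ y = ⌊ x ≟ y ⌋

mono : ∀ {n} → Fin n → Fin n → Tensor n
mono p q x y = (x ≟ᵇ p) ∧ (y ≟ᵇ q)

mono3 : ∀ {n} → Fin n → Fin n → Fin n → Cube n
mono3 a b c x y z = ((x ≟ᵇ a) ∧ (y ≟ᵇ b)) ∧ (z ≟ᵇ c)

_⊕_ : ∀ {n} → Tensor n → Tensor n → Tensor n
(u ⊕ v) x y = u x y xor v x y

sumF2 : ∀ {k} → (Fin k → Bool) → Bool
sumF2 {ℕ.zero} f = false
sumF2 {suc k} f = f zero xor sumF2 (λ i → f (Data.Fin.suc i))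

InSpan : ∀ {n k} → (Fin k → Tensor n) → Tensor n → Set
InSpan {n} {k} S v =
  Σ (Fin k → Bool) λ c → ∀ p q → v p q ≡ sumF2 (λ i → c i ∧ S i p q)

_≤lex_ : ∀ {n} → (Fin n × Fin n) → (Fin n × Fin n) → Set
(a , b) ≤lex (a' , b') = (toℕ a ℕ.< toℕ a') Data.Sum.⊎ ((a ≡ a') × (toℕ b ℕ.≤ toℕ b'))

IsLead : ∀ {n} → Tensor n → Fin n → Fin n → Set
IsLead w p q = (w p q ≡ true) × (∀ p' q' → w p' q' ≡ true → (p' , q') ≤lex (p , q))

record NormalizedBasis {n} (Ω : List (Tensor n)) : Set where
  field
    k      : ℕ
    rel    : Fin k → Tensor n
    ldL    : Fin k → Fin n
    ldR    : Fin k → Fin n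
    isLead : ∀ i → IsLead (rel i) (ldL i) (ldR i)
    alone  : ∀ i j → i ≢ j → rel j (ldL i) (ldR i) ≡ false
    inΩ    : ∀ i → InSpan (lookup Ω) (rel i)
    spansΩ : ∀ i → InSpan rel (lookup Ω i)
open NormalizedBasis public

module _ {n} {Ω : List (Tensor n)} (N : NormalizedBasis Ω) where

  IsLeadMono : Fin n → Fin n → Set
  IsLeadMono p q = ∃ λ i → (ldL N i ≡ p) × (ldR N i ≡ q)

  -- one rewriting step on a degree-3 element: replace an occurring monomial
  -- x_a x_b x_c whose left (resp. right) factor x_a x_b (resp. x_b x_c) is the
  -- leading monomial of relation i by the remaining terms of relation i
  -- (over F₂: add rel i ⊗ x_c, resp. x_a ⊗ rel i).
  data Step (f g : Cube n) : Set where
    left  : ∀ i c → f (ldL N i) (ldR N i) c ≡ true →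
            (∀ x y z → g x y z ≡ (f x y z xor (rel N i x y ∧ (z ≟ᵇ c)))) →
            Step f g
    right : ∀ i a → f a (ldL N i) (ldR N i) ≡ true →
            (∀ x y z → g x y z ≡ (f x y z xor ((x ≟ᵇ a) ∧ rel N i y z))) →
            Step f g

  Reduces : Cube n → Cube n → Set
  Reduces = Star Step

  IsNormal : Cube n → Set
  IsNormal f = ∀ x y z → f x y z ≡ true → ¬ IsLeadMono x y × ¬ IsLeadMono y z

  Critical : Fin n → Fin n → Fin n → Set
  Critical a b c = IsLeadMono a b × IsLeadMono b c

  Confluent : Fin n → Fin n → Fin n → Set
  Confluent a b c = ∀ g h → Reduces (mono3 a b c) g → Reduces (mono3 a b c) h →
                    IsNormal g → IsNormal h → ∀ x y z → g x y z ≡ h x y z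

IsPBW : ∀ {n} → List (Tensor n) → Set
IsPBW {n} Ω = Σ (NormalizedBasis Ω) λ N → ∀ a b c → Critical N a b c → Confluent N a b c

GradedCommutative : ∀ {n} → List (Tensor n) → Set
GradedCommutative Ω = ∀ u v → InSpan (lookup Ω) (mono u v ⊕ mono v u)

-- Twisted extension A[J;t]: generators of A are Fin (suc d) (index 0 = t,
-- index k = a_k); new generators x_j = raise (suc d) j for j : Fin m, placed
-- after them in the order.
module _ (d m : ℕ) where
  private
    n' = suc d + m
    g : Fin (suc d) → Fin n'
    g k = k ↑ˡ m
    xv : Fin m → Fin n'
    xv j = suc d ↑ʳ j
    t : Fin n'
    t = g zero

  embed : Tensor (suc d) → Tensor n'
  embed w p q with splitAt (suc d) p | splitAt (suc d) q
  ... | inj₁ p' | inj₁ q' = w p' q'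
  ... | _       | _       = false

  twistedRelators : List (Tensor (suc d)) → List (Tensor n')
  twistedRelators Ω =
    map embed Ω
    ++ concatMap (λ i → map (λ j → mono (xv i) (xv j) ⊕ mono (xv j) (xv i)) (allFinL m)) (allFinL m)
    ++ concatMap (λ j → map (λ k → mono (xv j) (g k) ⊕ mono (g k) (xv j)) (allFinL (suc d))) (allFinL m)
    ++ map (λ j → mono (xv j) (xv j) ⊕ mono t (xv j)) (allFinL m)

-- The relations of A, embedded, together with the binomials x_p x_q + x_q x_p
-- (q < p), x_p x_p + t x_p and x_p a_u + a_u x_p, whose tails are never leading
-- monomials, form a normalized basis of the relators of A[J;t].
--
-- A critical monomial in the letters of A only ever reduces inside A, so it is
-- confluent because A is PBW. A critical monomial involving some x_j never reduces
-- to monomials in letters of A alone, and the normal monomials it can reach are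
-- a_u a_v x_j, a_u x_i x_j (i < j) and x_i x_j x_k (i < j < k). Each of them is
-- detected by a linear functional Λ built from a model in which the x's commute
-- with everything, x_j x_j = t x_j, and words of length two in A are brought to
-- normal form (using that A is commutative). Λ is invariant under rewriting and
-- reads off the coefficient of its normal monomial, so all normal forms coincide.

module Submission where

open import Defs
open import Algebra.Bundles using (CommutativeRing; CommutativeMonoid)
open import Data.Bool using (Bool; true; false; _∧_; _xor_; if_then_else_)
open import Data.Bool.Properties
  using (xor-identityʳ; xor-assoc; xor-comm; xor-same; ∧-comm; ∧-assoc; ∧-zeroʳ; ∧-identityʳ; ¬-not;
         ∧-distribˡ-xor; ∧-distribʳ-xor; xor-∧-commutativeRing; ∧-commutativeMonoid)
open import Data.Empty using (⊥-elim)
open import Data.Fin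
  using (Fin; zero; suc; _↑ˡ_; _↑ʳ_; _≟_; _<_; _≤_; toℕ; splitAt; remQuot; combine)
import Data.Fin.Properties as Fin
open import Data.List using (List; []; _∷_; lookup; map; concatMap; _++_; allFin)
open import Data.List.Membership.Propositional using (_∈_)
open import Data.List.Membership.Propositional.Properties
  using (∈-map⁺; ∈-map⁻; ∈-++⁺ˡ; ∈-++⁺ʳ; ∈-++⁻; ∈-concatMap⁺; ∈-concatMap⁻; ∈-allFin; ∈-lookup)
open import Data.List.Relation.Binary.Pointwise using (Pointwise-≡⇒≡)
import Data.List.Relation.Unary.Any as Any
open import Data.List.Relation.Unary.Any.Properties using (lookup-index)
open import Data.Nat using (ℕ; suc; _+_; _*_; z≤n; s<s)
import Data.Nat.Properties as ℕ
open import Data.Product using (∃; ∃₂; _×_; _,_; proj₁; proj₂; uncurry)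
import Data.Product as Prod
open import Data.Sum using (_⊎_; inj₁; inj₂; [_,_]′)
open import Function using (_∘_)
open import Relation.Binary.Construct.Closure.ReflexiveTransitive using (ε; _◅_)
open import Relation.Binary.Definitions using (tri<; tri≈; tri>)
open import Relation.Binary.PropositionalEquality
open import Relation.Nullary using (¬_; yes; no)
open import Relation.Nullary.Decidable using (dec-true; dec-false)

open import Algebra.Properties.CommutativeSemigroup
  (CommutativeRing.+-commutativeSemigroup xor-∧-commutativeRing)
  using () renaming (interchange to xor-interchange)
open import Algebra.Properties.CommutativeSemigroup
  (CommutativeMonoid.commutativeSemigroup ∧-commutativeMonoid)
  using (xy∙z≈zy∙x) renaming (x∙yz≈y∙xz to ∧-swapˡ)

≟ᵇ-refl : ∀ {n} (x : Fin n) → (x ≟ᵇ x) ≡ true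
≟ᵇ-refl x with x ≟ x
... | yes _ = refl
... | no x≢x = ⊥-elim (x≢x refl)

≟ᵇ-≢ : ∀ {n} {x y : Fin n} → x ≢ y → (x ≟ᵇ y) ≡ false
≟ᵇ-≢ {x = x} {y} x≢y with x ≟ y
... | yes x≡y = ⊥-elim (x≢y x≡y)
... | no _ = refl

≟ᵇ⇒≡ : ∀ {n} {x y : Fin n} → (x ≟ᵇ y) ≡ true → x ≡ y
≟ᵇ⇒≡ {x = x} {y} eq with x ≟ y
... | yes x≡y = x≡y

≟ᵇ-sym : ∀ {n} (x y : Fin n) → (x ≟ᵇ y) ≡ (y ≟ᵇ x)
≟ᵇ-sym x y with y ≟ x
... | yes refl = ≟ᵇ-refl x
... | no y≢x = ≟ᵇ-≢ (λ x≡y → y≢x (sym x≡y))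

≟ᵇ-injective : ∀ {a b} {f : Fin a → Fin b} → (∀ {x y} → f x ≡ f y → x ≡ y) →
               ∀ x y → (f x ≟ᵇ f y) ≡ (x ≟ᵇ y)
≟ᵇ-injective {f = f} f-inj x y with x ≟ y
... | yes refl = ≟ᵇ-refl (f x)
... | no x≢y = ≟ᵇ-≢ (λ fx≡fy → x≢y (f-inj fx≡fy))

true≢false : true ≢ false
true≢false ()

xor≡true : ∀ {a b} → a xor b ≡ true → a ≡ true ⊎ b ≡ true
xor≡true {true} _ = inj₁ refl
xor≡true {false} b≡true = inj₂ b≡true

∧≡true : ∀ {a b} → a ∧ b ≡ true → a ≡ true × b ≡ true
∧≡true {true} {true} _ = refl , refl

≡true⇔⇒≡ : ∀ {a b} → (a ≡ true → b ≡ true) → (b ≡ true → a ≡ true) → a ≡ b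
≡true⇔⇒≡ {true} a⇒b _ = sym (a⇒b refl)
≡true⇔⇒≡ {false} {true} _ b⇒a = b⇒a refl
≡true⇔⇒≡ {false} {false} _ _ = refl

xor≡false⇒≡ : ∀ {a b} → a xor b ≡ false → a ≡ b
xor≡false⇒≡ {true} {true} _ = refl
xor≡false⇒≡ {false} {false} _ = refl

≡⇒xor≡false : ∀ {a b} → a ≡ b → a xor b ≡ false
≡⇒xor≡false {a} refl = xor-same a

sumF2-cong : ∀ {k} {f g : Fin k → Bool} → (∀ i → f i ≡ g i) → sumF2 f ≡ sumF2 g
sumF2-cong {ℕ.zero} f≗g = refl
sumF2-cong {ℕ.suc k} f≗g = cong₂ _xor_ (f≗g zero) (sumF2-cong (λ i → f≗g (suc i)))

sumF2-false : ∀ {k} {f : Fin k → Bool} → (∀ i → f i ≡ false) → sumF2 f ≡ false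
sumF2-false {ℕ.zero} f≗0 = refl
sumF2-false {ℕ.suc k} f≗0 = cong₂ _xor_ (f≗0 zero) (sumF2-false (λ i → f≗0 (suc i)))

sumF2-xor : ∀ {k} (f g : Fin k → Bool) → sumF2 (λ i → f i xor g i) ≡ sumF2 f xor sumF2 g
sumF2-xor {ℕ.zero} f g = refl
sumF2-xor {ℕ.suc k} f g = trans (cong ((f zero xor g zero) xor_) (sumF2-xor (f ∘ suc) (g ∘ suc)))
  (xor-interchange (f zero) (g zero) _ _)

sumF2-∧ˡ : ∀ {k} b (f : Fin k → Bool) → sumF2 (λ i → b ∧ f i) ≡ b ∧ sumF2 f
sumF2-∧ˡ {ℕ.zero} b f = sym (∧-zeroʳ b)
sumF2-∧ˡ {ℕ.suc k} b f =
  trans (cong ((b ∧ f zero) xor_) (sumF2-∧ˡ b (f ∘ suc))) (sym (∧-distribˡ-xor b _ _))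

sumF2-∧ʳ : ∀ {k} b (f : Fin k → Bool) → sumF2 (λ i → f i ∧ b) ≡ sumF2 f ∧ b
sumF2-∧ʳ b f = trans (sumF2-cong (λ i → ∧-comm (f i) b)) (trans (sumF2-∧ˡ b f) (∧-comm b _))

sumF2-select : ∀ {k} (c : Fin k) (f : Fin k → Bool) → sumF2 (λ i → (i ≟ᵇ c) ∧ f i) ≡ f c
sumF2-select {ℕ.suc k} zero f =
  trans (cong (f zero xor_) (sumF2-false {k} (λ _ → refl))) (xor-identityʳ (f zero))
sumF2-select {ℕ.suc k} (suc c) f =
  trans (sumF2-cong (λ i → cong (_∧ f (suc i)) (≟ᵇ-injective Fin.suc-injective i c)))
        (sumF2-select c (f ∘ suc))

sumF2-swap : ∀ {k l} (f : Fin k → Fin l → Bool) →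
             sumF2 (λ i → sumF2 (f i)) ≡ sumF2 (λ j → sumF2 (λ i → f i j))
sumF2-swap {ℕ.zero} {l} f = sym (sumF2-false {l} (λ _ → refl))
sumF2-swap {ℕ.suc k} f = trans (cong (sumF2 (f zero) xor_) (sumF2-swap (f ∘ suc)))
  (sym (sumF2-xor (f zero) (λ j → sumF2 (λ i → f (suc i) j))))

sumF2-++ : ∀ a b (f : Fin (a + b) → Bool) →
           sumF2 f ≡ sumF2 (λ i → f (i ↑ˡ b)) xor sumF2 (λ j → f (a ↑ʳ j))
sumF2-++ ℕ.zero b f = refl
sumF2-++ (ℕ.suc a) b f =
  trans (cong (f zero xor_) (sumF2-++ a b (f ∘ suc))) (sym (xor-assoc (f zero) _ _))

InSpan-cong : ∀ {n k} {S : Fin k → Tensor n} {v w : Tensor n} →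
              (∀ p q → v p q ≡ w p q) → InSpan S v → InSpan S w
InSpan-cong v≗w (c , v≡) = c , λ p q → trans (sym (v≗w p q)) (v≡ p q)

InSpan-generator : ∀ {n k} (S : Fin k → Tensor n) i → InSpan S (S i)
InSpan-generator S i = (_≟ᵇ i) , λ p q → sym (sumF2-select i (λ l → S l p q))

InSpan-zero : ∀ {n k} (S : Fin k → Tensor n) {v : Tensor n} → (∀ p q → v p q ≡ false) → InSpan S v
InSpan-zero {k = k} S v≗0 = (λ _ → false) , λ p q → trans (v≗0 p q) (sym (sumF2-false {k} (λ _ → refl)))

InSpan-⊕ : ∀ {n k} {S : Fin k → Tensor n} {v w : Tensor n} → InSpan S v → InSpan S w → InSpan S (v ⊕ w)
InSpan-⊕ {S = S} (c , v≡) (c′ , w≡) = (λ i → c i xor c′ i) , λ p q →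
  trans (cong₂ _xor_ (v≡ p q) (w≡ p q))
  (trans (sym (sumF2-xor (λ i → c i ∧ S i p q) (λ i → c′ i ∧ S i p q)))
         (sumF2-cong (λ i → sym (∧-distribʳ-xor (S i p q) (c i) (c′ i)))))

InSpan-combination : ∀ {n k l} {T : Fin l → Tensor n} (S : Fin k → Tensor n) → (∀ i → InSpan T (S i)) →
                     (c : Fin k → Bool) → InSpan T (λ p q → sumF2 (λ i → c i ∧ S i p q))
InSpan-combination {k = ℕ.zero} {T = T} S S⊆T c = InSpan-zero T (λ _ _ → refl)
InSpan-combination {k = ℕ.suc k} S S⊆T c with c zero
... | true = InSpan-⊕ (S⊆T zero) (InSpan-combination (S ∘ suc) (S⊆T ∘ suc) (c ∘ suc))
... | false = InSpan-combination (S ∘ suc) (S⊆T ∘ suc) (c ∘ suc)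

InSpan-trans : ∀ {n k l} {T : Fin l → Tensor n} {S : Fin k → Tensor n} {v : Tensor n} →
               (∀ i → InSpan T (S i)) → InSpan S v → InSpan T v
InSpan-trans {S = S} S⊆T (c , v≡) = InSpan-cong (λ p q → sym (v≡ p q)) (InSpan-combination S S⊆T c)

mono⇒≡ : ∀ {n} {a b x y : Fin n} → mono a b x y ≡ true → x ≡ a × y ≡ b
mono⇒≡ eq with ∧≡true eq
... | x≟a , y≟b = ≟ᵇ⇒≡ x≟a , ≟ᵇ⇒≡ y≟b

mono-self : ∀ {n} (a b : Fin n) → mono a b a b ≡ true
mono-self a b = cong₂ _∧_ (≟ᵇ-refl a) (≟ᵇ-refl b)

mono-≢ˡ : ∀ {n} {a b c e : Fin n} → a ≢ c → mono c e a b ≡ false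
mono-≢ˡ a≢c = cong (_∧ _) (≟ᵇ-≢ a≢c)

mono-sym : ∀ {n} (a b x y : Fin n) → mono a b x y ≡ mono x y a b
mono-sym a b x y = cong₂ _∧_ (≟ᵇ-sym x a) (≟ᵇ-sym y b)

binomial⇒≡ : ∀ {n} {a b c e x y : Fin n} → (mono a b ⊕ mono c e) x y ≡ true →
             (x ≡ a × y ≡ b) ⊎ (x ≡ c × y ≡ e)
binomial⇒≡ eq with xor≡true eq
... | inj₁ ab = inj₁ (mono⇒≡ ab)
... | inj₂ ce = inj₂ (mono⇒≡ ce)

module _ {n : ℕ} where

  Σ² : (Fin n → Fin n → Bool) → Bool
  Σ² F = sumF2 (λ x → sumF2 (F x))

  Σ³ : (Fin n → Fin n → Fin n → Bool) → Bool
  Σ³ F = sumF2 (λ x → Σ² (F x))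

  Σ²-cong : ∀ {F G : Fin n → Fin n → Bool} → (∀ x y → F x y ≡ G x y) → Σ² F ≡ Σ² G
  Σ²-cong F≗G = sumF2-cong (λ x → sumF2-cong (F≗G x))

  Σ³-cong : ∀ {F G : Fin n → Fin n → Fin n → Bool} → (∀ x y z → F x y z ≡ G x y z) → Σ³ F ≡ Σ³ G
  Σ³-cong F≗G = sumF2-cong (λ x → Σ²-cong (F≗G x))

  Σ²-false : ∀ {F : Fin n → Fin n → Bool} → (∀ x y → F x y ≡ false) → Σ² F ≡ false
  Σ²-false F≗0 = sumF2-false (λ x → sumF2-false (F≗0 x))

  Σ²-xor : ∀ F G → Σ² (λ x y → F x y xor G x y) ≡ Σ² F xor Σ² G
  Σ²-xor F G = trans (sumF2-cong (λ x → sumF2-xor (F x) (G x))) (sumF2-xor (sumF2 ∘ F) (sumF2 ∘ G))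

  Σ³-xor : ∀ F G → Σ³ (λ x y z → F x y z xor G x y z) ≡ Σ³ F xor Σ³ G
  Σ³-xor F G = trans (sumF2-cong (λ x → Σ²-xor (F x) (G x))) (sumF2-xor (Σ² ∘ F) (Σ² ∘ G))

  Σ²-∧ˡ : ∀ b F → Σ² (λ x y → b ∧ F x y) ≡ b ∧ Σ² F
  Σ²-∧ˡ b F = trans (sumF2-cong (λ x → sumF2-∧ˡ b (F x))) (sumF2-∧ˡ b (sumF2 ∘ F))

  Σ²-mono : ∀ (F : Fin n → Fin n → Bool) a b → Σ² (λ x y → mono a b x y ∧ F x y) ≡ F a b
  Σ²-mono F a b = begin
    sumF2 (λ x → sumF2 (λ y → ((x ≟ᵇ a) ∧ (y ≟ᵇ b)) ∧ F x y))
      ≡⟨ sumF2-cong (λ x → trans (sumF2-cong (λ y → ∧-assoc (x ≟ᵇ a) (y ≟ᵇ b) (F x y)))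
                                 (sumF2-∧ˡ (x ≟ᵇ a) (λ y → (y ≟ᵇ b) ∧ F x y))) ⟩
    sumF2 (λ x → (x ≟ᵇ a) ∧ sumF2 (λ y → (y ≟ᵇ b) ∧ F x y))
      ≡⟨ sumF2-select a _ ⟩
    sumF2 (λ y → (y ≟ᵇ b) ∧ F a y)
      ≡⟨ sumF2-select b (F a) ⟩
    F a b ∎
    where open ≡-Reasoning

  Σ²-monoʳ : ∀ (F : Fin n → Fin n → Bool) a b → Σ² (λ x y → F x y ∧ mono a b x y) ≡ F a b
  Σ²-monoʳ F a b = trans (Σ²-cong (λ x y → ∧-comm (F x y) _)) (Σ²-mono F a b)

  Σ²-binomial : ∀ (F : Fin n → Fin n → Bool) a b c e →
                Σ² (λ x y → (mono a b ⊕ mono c e) x y ∧ F x y) ≡ F a b xor F c e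
  Σ²-binomial F a b c e = begin
    Σ² (λ x y → (mono a b x y xor mono c e x y) ∧ F x y)
      ≡⟨ Σ²-cong (λ x y → ∧-distribʳ-xor (F x y) (mono a b x y) (mono c e x y)) ⟩
    Σ² (λ x y → (mono a b x y ∧ F x y) xor (mono c e x y ∧ F x y))
      ≡⟨ Σ²-xor _ _ ⟩
    Σ² (λ x y → mono a b x y ∧ F x y) xor Σ² (λ x y → mono c e x y ∧ F x y)
      ≡⟨ cong₂ _xor_ (Σ²-mono F a b) (Σ²-mono F c e) ⟩
    F a b xor F c e ∎
    where open ≡-Reasoning

  Σ³-mono3ʳ : ∀ (g : Cube n) a b c → Σ³ (λ x y z → g x y z ∧ mono3 a b c x y z) ≡ g a b c
  Σ³-mono3ʳ g a b c = trans
    (sumF2-cong (λ x → sumF2-cong (λ y → trans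
      (sumF2-cong (λ z → ∧-swapˡ (g x y z) (mono a b x y) (z ≟ᵇ c)))
      (trans (sumF2-∧ˡ (mono a b x y) (λ z → g x y z ∧ (z ≟ᵇ c)))
             (cong (mono a b x y ∧_) (trans (sumF2-cong (λ z → ∧-comm (g x y z) _))
                                            (sumF2-select c (g x y))))))))
    (Σ²-mono (λ x y → g x y c) a b)

  Σ³-selectʳ : ∀ (R : Fin n → Fin n → Bool) c (M : Cube n) →
               Σ³ (λ x y z → (R x y ∧ (z ≟ᵇ c)) ∧ M x y z) ≡ Σ² (λ x y → R x y ∧ M x y c)
  Σ³-selectʳ R c M = Σ²-cong (λ x y → trans
    (sumF2-cong (λ z → trans (cong (_∧ M x y z) (∧-comm (R x y) (z ≟ᵇ c))) (∧-assoc (z ≟ᵇ c) (R x y) (M x y z))))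
    (sumF2-select c (λ z → R x y ∧ M x y z)))

  Σ³-selectˡ : ∀ (R : Fin n → Fin n → Bool) a (M : Cube n) →
               Σ³ (λ x y z → ((x ≟ᵇ a) ∧ R y z) ∧ M x y z) ≡ Σ² (λ y z → R y z ∧ M a y z)
  Σ³-selectˡ R a M = trans
    (sumF2-cong (λ x → trans (Σ²-cong (λ y z → ∧-assoc (x ≟ᵇ a) (R y z) (M x y z)))
                             (Σ²-∧ˡ (x ≟ᵇ a) (λ y z → R y z ∧ M x y z))))
    (sumF2-select a (λ x → Σ² (λ y z → R y z ∧ M x y z)))

module NormalForm {n} {Ω : List (Tensor n)} (N : NormalizedBasis Ω) where

  -- The coefficient of x_u x_v in the normal form of w: every leading monomial
  -- occurs in exactly one basis relation, so one round of rewriting suffices.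
  nf : Fin n → Fin n → Tensor n → Bool
  nf u v w = w u v xor sumF2 (λ i → w (ldL N i) (ldR N i) ∧ rel N i u v)

  nf-cong : ∀ u v {w w′ : Tensor n} → (∀ p q → w p q ≡ w′ p q) → nf u v w ≡ nf u v w′
  nf-cong u v w≗w′ =
    cong₂ _xor_ (w≗w′ u v) (sumF2-cong (λ i → cong (_∧ rel N i u v) (w≗w′ (ldL N i) (ldR N i))))

  nf-⊕ : ∀ u v (w w′ : Tensor n) → nf u v (w ⊕ w′) ≡ nf u v w xor nf u v w′
  nf-⊕ u v w w′ = begin
    (w u v xor w′ u v) xor sumF2 (λ i → (lead w i xor lead w′ i) ∧ rel N i u v)
      ≡⟨ cong ((w u v xor w′ u v) xor_)
              (trans (sumF2-cong (λ i → ∧-distribʳ-xor (rel N i u v) (lead w i) (lead w′ i)))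
                     (sumF2-xor {k N} _ _)) ⟩
    (w u v xor w′ u v) xor (sumF2 (λ i → lead w i ∧ rel N i u v) xor sumF2 (λ i → lead w′ i ∧ rel N i u v))
      ≡⟨ xor-interchange (w u v) (w′ u v) _ _ ⟩
    nf u v w xor nf u v w′ ∎
    where
    open ≡-Reasoning
    lead : Tensor n → Fin (k N) → Bool
    lead w i = w (ldL N i) (ldR N i)

  rel-at-lead : ∀ l i → rel N l (ldL N i) (ldR N i) ≡ (i ≟ᵇ l)
  rel-at-lead l i with i ≟ l
  ... | yes refl = proj₁ (isLead N l)
  ... | no i≢l = alone N i l i≢l

  nf-rel : ∀ u v l → nf u v (rel N l) ≡ false
  nf-rel u v l = trans
    (cong (rel N l u v xor_) (trans (sumF2-cong (λ i → cong (_∧ rel N i u v) (rel-at-lead l i)))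
                                    (sumF2-select l (λ i → rel N i u v))))
    (xor-same (rel N l u v))

  nf-combination : ∀ u v {k′} (c : Fin k′ → Bool) (S : Fin k′ → Tensor n) →
                   nf u v (λ p q → sumF2 (λ j → c j ∧ S j p q)) ≡ sumF2 (λ j → c j ∧ nf u v (S j))
  nf-combination u v {k′} c S = begin
    sumF2 (λ j → c j ∧ S j u v) xor sumF2 (λ i → sumF2 (λ j → c j ∧ lead j i) ∧ rel N i u v)
      ≡⟨ cong (sumF2 (λ j → c j ∧ S j u v) xor_) (begin
           sumF2 (λ i → sumF2 (λ j → c j ∧ lead j i) ∧ rel N i u v)
             ≡⟨ sumF2-cong (λ i → sym (sumF2-∧ʳ {k′} (rel N i u v) _)) ⟩
           sumF2 (λ i → sumF2 (λ j → (c j ∧ lead j i) ∧ rel N i u v))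
             ≡⟨ sumF2-swap {k N} {k′} _ ⟩
           sumF2 (λ j → sumF2 (λ i → (c j ∧ lead j i) ∧ rel N i u v))
             ≡⟨ sumF2-cong (λ j → trans (sumF2-cong (λ i → ∧-assoc (c j) (lead j i) (rel N i u v)))
                                        (sumF2-∧ˡ {k N} (c j) _)) ⟩
           sumF2 (λ j → c j ∧ sumF2 (λ i → lead j i ∧ rel N i u v)) ∎) ⟩
    sumF2 (λ j → c j ∧ S j u v) xor sumF2 (λ j → c j ∧ sumF2 (λ i → lead j i ∧ rel N i u v))
      ≡⟨ sym (sumF2-xor {k′} _ _) ⟩
    sumF2 (λ j → (c j ∧ S j u v) xor (c j ∧ sumF2 (λ i → lead j i ∧ rel N i u v)))
      ≡⟨ sumF2-cong (λ j → sym (∧-distribˡ-xor (c j) _ _)) ⟩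
    sumF2 (λ j → c j ∧ nf u v (S j)) ∎
    where
    open ≡-Reasoning
    lead : Fin k′ → Fin (k N) → Bool
    lead j i = S j (ldL N i) (ldR N i)

  nf-span : ∀ u v {w : Tensor n} → InSpan (rel N) w → nf u v w ≡ false
  nf-span u v (c , w≡) = trans (nf-cong u v w≡) (trans (nf-combination u v c (rel N))
    (sumF2-false (λ j → trans (cong (c j ∧_) (nf-rel u v j)) (∧-zeroʳ (c j)))))

  nf-expand : ∀ u v (w : Tensor n) → Σ² (λ p q → w p q ∧ nf u v (mono p q)) ≡ nf u v w
  nf-expand u v w = begin
    Σ² (λ p q → w p q ∧ (mono p q u v xor sumF2 (λ i → mono p q (ldL N i) (ldR N i) ∧ rel N i u v)))
      ≡⟨ Σ²-cong (λ p q → ∧-distribˡ-xor (w p q) _ _) ⟩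
    Σ² (λ p q → (w p q ∧ mono p q u v) xor (w p q ∧ sumF2 (λ i → mono p q (ldL N i) (ldR N i) ∧ rel N i u v)))
      ≡⟨ Σ²-xor {n} _ _ ⟩
    Σ² (λ p q → w p q ∧ mono p q u v) xor Σ² (λ p q → w p q ∧ sumF2 (λ i → mono p q (ldL N i) (ldR N i) ∧ rel N i u v))
      ≡⟨ cong₂ _xor_ coefficient correction ⟩
    nf u v w ∎
    where
    open ≡-Reasoning
    coefficient : Σ² (λ p q → w p q ∧ mono p q u v) ≡ w u v
    coefficient = trans (Σ²-cong (λ p q → cong (w p q ∧_) (mono-sym p q u v))) (Σ²-monoʳ w u v)
    term : Fin (k N) → Fin n → Fin n → Bool
    term i p q = w p q ∧ (mono p q (ldL N i) (ldR N i) ∧ rel N i u v)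
    lead-term : Fin (k N) → Fin n → Fin n → Bool
    lead-term i p q = w p q ∧ mono (ldL N i) (ldR N i) p q
    correction : Σ² (λ p q → w p q ∧ sumF2 (λ i → mono p q (ldL N i) (ldR N i) ∧ rel N i u v))
                 ≡ sumF2 (λ i → w (ldL N i) (ldR N i) ∧ rel N i u v)
    correction = begin
      sumF2 (λ p → sumF2 (λ q → w p q ∧ sumF2 (λ i → mono p q (ldL N i) (ldR N i) ∧ rel N i u v)))
        ≡⟨ Σ²-cong (λ p q → sym (sumF2-∧ˡ {k N} (w p q) _)) ⟩
      sumF2 (λ p → sumF2 (λ q → sumF2 (λ i → w p q ∧ (mono p q (ldL N i) (ldR N i) ∧ rel N i u v))))
        ≡⟨ trans (sumF2-cong (λ p → sumF2-swap (λ q i → term i p q)))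
                 (sumF2-swap (λ p i → sumF2 (term i p))) ⟩
      sumF2 (λ i → Σ² (λ p q → w p q ∧ (mono p q (ldL N i) (ldR N i) ∧ rel N i u v)))
        ≡⟨ sumF2-cong (λ i → trans (Σ²-cong (λ p q → trans (sym (∧-assoc (w p q) _ (rel N i u v)))
                                      (cong (λ z → (w p q ∧ z) ∧ rel N i u v) (mono-sym p q (ldL N i) (ldR N i)))))
                                  (trans (sumF2-cong (λ p → sumF2-∧ʳ (rel N i u v) (λ q → lead-term i p q)))
                                         (sumF2-∧ʳ (rel N i u v) (λ p → sumF2 (lead-term i p))))) ⟩
      sumF2 (λ i → Σ² (λ p q → w p q ∧ mono (ldL N i) (ldR N i) p q) ∧ rel N i u v)
        ≡⟨ sumF2-cong (λ i → cong (_∧ rel N i u v) (Σ²-monoʳ w (ldL N i) (ldR N i))) ⟩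
      sumF2 (λ i → w (ldL N i) (ldR N i) ∧ rel N i u v) ∎

  nf-comm : GradedCommutative Ω → ∀ u v a b → nf u v (mono a b) ≡ nf u v (mono b a)
  nf-comm commutative u v a b = xor≡false⇒≡ (trans (sym (nf-⊕ u v (mono a b) (mono b a)))
    (nf-span u v (InSpan-trans (spansΩ N) (commutative a b))))

  nf-normal : ∀ u v {a b} → ¬ IsLeadMono N a b → nf u v (mono a b) ≡ mono u v a b
  nf-normal u v {a} {b} ¬lead = trans
    (cong₂ _xor_ (mono-sym a b u v) (sumF2-false not-lead))
    (xor-identityʳ _)
    where
    not-lead : ∀ i → mono a b (ldL N i) (ldR N i) ∧ rel N i u v ≡ false
    not-lead i with mono a b (ldL N i) (ldR N i) in eq
    ... | false = refl
    ... | true = ⊥-elim (¬lead (i , mono⇒≡ eq))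

IsLead-binomial : ∀ {n} {a b c e : Fin n} → c < a → IsLead (mono a b ⊕ mono c e) a b
IsLead-binomial {a = a} {b} {c} {e} c<a =
  cong₂ _xor_ (mono-self a b) (mono-≢ˡ (Fin.<⇒≢ c<a ∘ sym)) , bound
  where
  bound : ∀ p q → (mono a b ⊕ mono c e) p q ≡ true → (p , q) ≤lex (a , b)
  bound p q eq with binomial⇒≡ {a = a} {b} {c} {e} {p} {q} eq
  ... | inj₁ (refl , refl) = inj₂ (refl , ℕ.≤-refl)
  ... | inj₂ (refl , refl) = inj₁ c<a

[,]∘splitAt-injective : ∀ {a b} {X : Set} (f : Fin a → X) (g : Fin b → X) →
  (∀ {x y} → f x ≡ f y → x ≡ y) → (∀ {x y} → g x ≡ g y → x ≡ y) → (∀ x y → f x ≢ g y) →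
  ∀ {i j} → [ f , g ]′ (splitAt a i) ≡ [ f , g ]′ (splitAt a j) → i ≡ j
[,]∘splitAt-injective {a} {b} f g f-inj g-inj f≢g {i} {j} eq with splitAt a i in eqi | splitAt a j in eqj
... | inj₁ x | inj₁ y = trans (sym (Fin.splitAt⁻¹-↑ˡ eqi)) (trans (cong (_↑ˡ b) (f-inj eq)) (Fin.splitAt⁻¹-↑ˡ eqj))
... | inj₂ x | inj₂ y = trans (sym (Fin.splitAt⁻¹-↑ʳ eqi)) (trans (cong (a ↑ʳ_) (g-inj eq)) (Fin.splitAt⁻¹-↑ʳ eqj))
... | inj₁ x | inj₂ y = ⊥-elim (f≢g x y eq)
... | inj₂ x | inj₁ y = ⊥-elim (f≢g y x (sym eq))

triangle : ℕ → ℕ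
triangle ℕ.zero = 0
triangle (ℕ.suc m) = m + triangle m

pairBelow : ∀ {m} → Fin (triangle m) → Fin m × Fin m
pairBelow {ℕ.suc m} i = [ (λ p → suc p , zero) , Prod.map suc suc ∘ pairBelow ]′ (splitAt m i)

pairBelow-< : ∀ {m} (i : Fin (triangle m)) → proj₂ (pairBelow {m} i) < proj₁ (pairBelow {m} i)
pairBelow-< {ℕ.suc m} i with splitAt m i
... | inj₁ p = s<s z≤n
... | inj₂ r = s<s (pairBelow-< {m} r)

pairBelow-injective : ∀ {m} {i j : Fin (triangle m)} → pairBelow {m} i ≡ pairBelow {m} j → i ≡ j
pairBelow-injective {ℕ.suc m} = [,]∘splitAt-injective (λ p → suc p , zero) (Prod.map suc suc ∘ pairBelow {m})
  (λ eq → Fin.suc-injective (cong proj₁ eq))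
  (λ eq → pairBelow-injective {m} (cong₂ _,_ (Fin.suc-injective (cong proj₁ eq)) (Fin.suc-injective (cong proj₂ eq))))
  (λ _ _ ())

pairBelow-surjective : ∀ {m} (p q : Fin m) → q < p → ∃ λ i → pairBelow {m} i ≡ (p , q)
pairBelow-surjective {ℕ.suc m} (suc p) zero _ = p ↑ˡ triangle m , cong [ _ , _ ]′ (Fin.splitAt-↑ˡ m p (triangle m))
pairBelow-surjective {ℕ.suc m} (suc p) (suc q) (s<s q<p) with pairBelow-surjective p q q<p
... | i , refl = m ↑ʳ i , cong [ _ , _ ]′ (Fin.splitAt-↑ʳ m (triangle m) i)

module SortedSupport (m : ℕ) where

  open import Data.List.Sort.InsertionSort.Base (Fin.≤-decTotalOrder m) public using (insert)
  open import Data.List.Sort.InsertionSort.Properties (Fin.≤-decTotalOrder m) using (insert-swap)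

  insert-comm : ∀ a b l → insert a (insert b l) ≡ insert b (insert a l)
  insert-comm a b l = Pointwise-≡⇒≡ (insert-swap a b l)

  insert-≤ : ∀ {a b} l → a ≤ b → insert a (b ∷ l) ≡ a ∷ b ∷ l
  insert-≤ {a} {b} l a≤b rewrite dec-true (a Fin.≤? b) a≤b = refl

  insert-≰ : ∀ {a b} l → ¬ a ≤ b → insert a (b ∷ l) ≡ b ∷ insert a l
  insert-≰ {a} {b} l a≰b rewrite dec-false (a Fin.≤? b) a≰b = refl

  _≐head_ : Fin m → List (Fin m) → Bool
  a ≐head [] = false
  a ≐head (b ∷ _) = a ≟ᵇ b

  -- Reading a sorted list from the right, a repeated index x_a x_a is replaced
  -- by x_a and one extra factor t; the counter records the number of t's.
  push : Fin m → List (Fin m) × ℕ → List (Fin m) × ℕ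
  push a (S , k) = if a ≐head S then (S , suc k) else (a ∷ S , k)

  collapse : List (Fin m) → List (Fin m) × ℕ
  collapse [] = [] , 0
  collapse (a ∷ l) = push a (collapse l)

  withT : List (Fin m) × ℕ → List (Fin m) × ℕ
  withT (S , k) = S , suc k

  push-withT : ∀ a C → push a (withT C) ≡ withT (push a C)
  push-withT a (S , k) with a ≐head S
  ... | true = refl
  ... | false = refl

  push-twice : ∀ a C → push a (push a C) ≡ withT (push a C)
  push-twice a (S , k) with a ≐head S in head≡a
  ... | true rewrite head≡a = refl
  ... | false rewrite ≟ᵇ-refl a = refl

  collapse-square : ∀ a l → collapse (insert a (insert a l)) ≡ withT (collapse (insert a l))
  collapse-square a [] rewrite insert-≤ [] (Fin.≤-refl {x = a}) | ≟ᵇ-refl a = refl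
  collapse-square a (b ∷ l) with a Fin.≤? b
  ... | yes a≤b rewrite insert-≤ l a≤b | insert-≤ (b ∷ l) (Fin.≤-refl {x = a}) = push-twice a (collapse (b ∷ l))
  ... | no a≰b rewrite insert-≰ l a≰b | insert-≰ (insert a l) a≰b =
    trans (cong (push b) (collapse-square a l)) (push-withT b (collapse (insert a l)))

  collapse-increasing₂ : ∀ {i j} → i < j → collapse (insert i (insert j [])) ≡ (i ∷ j ∷ [] , 0)
  collapse-increasing₂ i<j rewrite insert-≤ [] (ℕ.<⇒≤ i<j) | ≟ᵇ-≢ (Fin.<⇒≢ i<j) = refl

  collapse-increasing₃ : ∀ {i j k} → i < j → j < k →
                         collapse (insert i (insert j (insert k []))) ≡ (i ∷ j ∷ k ∷ [] , 0)
  collapse-increasing₃ {k = k} i<j j<k rewrite insert-≤ [] (ℕ.<⇒≤ j<k) | insert-≤ (k ∷ []) (ℕ.<⇒≤ i<j)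
    | ≟ᵇ-≢ (Fin.<⇒≢ j<k) | ≟ᵇ-≢ (Fin.<⇒≢ i<j) = refl

∈⇒InSpan : ∀ {n} {L : List (Tensor n)} {w} → w ∈ L → InSpan (lookup L) w
∈⇒InSpan {L = L} w∈L =
  InSpan-cong (λ p q → cong (λ v → v p q) (sym (lookup-index w∈L))) (InSpan-generator (lookup L) (Any.index w∈L))

module _ {X : Set} {a b} (f : Fin a → Fin b → X) where

  ∈-pairs⁺ : ∀ i j → f i j ∈ concatMap (λ i → map (f i) (allFin b)) (allFin a)
  ∈-pairs⁺ i j = ∈-concatMap⁺ (λ i → map (f i) (allFin b))
    (Any.map (λ { refl → ∈-map⁺ (f i) (∈-allFin j) }) (∈-allFin i))

  ∈-pairs⁻ : ∀ {y} → y ∈ concatMap (λ i → map (f i) (allFin b)) (allFin a) → ∃₂ λ i j → y ≡ f i j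
  ∈-pairs⁻ y∈ with Any.satisfied (∈-concatMap⁻ (λ i → map (f i) (allFin b)) {xs = allFin a} y∈)
  ... | i , y∈fi with ∈-map⁻ (f i) y∈fi
  ... | j , _ , refl = i , j , refl

module Alphabet (d m : ℕ) where

  D : ℕ
  D = ℕ.suc d

  n′ : ℕ
  n′ = D + m

  a⟨_⟩ : Fin D → Fin n′
  a⟨ u ⟩ = u ↑ˡ m

  x⟨_⟩ : Fin m → Fin n′
  x⟨ j ⟩ = D ↑ʳ j

  t : Fin n′
  t = a⟨ zero ⟩

  data View : Fin n′ → Set where
    a-view : ∀ u → View a⟨ u ⟩
    x-view : ∀ j → View x⟨ j ⟩

  view : ∀ p → View p
  view p with splitAt D p in eq
  ... | inj₁ u = subst View (Fin.splitAt⁻¹-↑ˡ eq) (a-view u)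
  ... | inj₂ j = subst View (Fin.splitAt⁻¹-↑ʳ eq) (x-view j)

  a<x : ∀ u j → a⟨ u ⟩ < x⟨ j ⟩
  a<x u j rewrite Fin.toℕ-↑ˡ u m | Fin.toℕ-↑ʳ D j = ℕ.<-≤-trans (Fin.toℕ<n u) (ℕ.m≤m+n D (toℕ j))

  a-<⁺ : ∀ {u v} → u < v → a⟨ u ⟩ < a⟨ v ⟩
  a-<⁺ {u} {v} u<v rewrite Fin.toℕ-↑ˡ u m | Fin.toℕ-↑ˡ v m = u<v

  a-≤⁺ : ∀ {u v} → u ≤ v → a⟨ u ⟩ ≤ a⟨ v ⟩
  a-≤⁺ {u} {v} u≤v rewrite Fin.toℕ-↑ˡ u m | Fin.toℕ-↑ˡ v m = u≤v

  a≢x : ∀ {u j} → a⟨ u ⟩ ≢ x⟨ j ⟩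
  a≢x {u} {j} = Fin.<⇒≢ (a<x u j)

  x≢a : ∀ {j u} → x⟨ j ⟩ ≢ a⟨ u ⟩
  x≢a = a≢x ∘ sym

  a-injective : ∀ {u v} → a⟨ u ⟩ ≡ a⟨ v ⟩ → u ≡ v
  a-injective = Fin.↑ˡ-injective m _ _

  x-injective : ∀ {i j} → x⟨ i ⟩ ≡ x⟨ j ⟩ → i ≡ j
  x-injective = Fin.↑ʳ-injective D _ _

  a≟ᵇa : ∀ u v → (a⟨ u ⟩ ≟ᵇ a⟨ v ⟩) ≡ (u ≟ᵇ v)
  a≟ᵇa = ≟ᵇ-injective a-injective

  x≟ᵇx : ∀ i j → (x⟨ i ⟩ ≟ᵇ x⟨ j ⟩) ≡ (i ≟ᵇ j)
  x≟ᵇx = ≟ᵇ-injective x-injective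

  a≟ᵇx : ∀ u j → (a⟨ u ⟩ ≟ᵇ x⟨ j ⟩) ≡ false
  a≟ᵇx u j = ≟ᵇ-≢ a≢x

  x≟ᵇa : ∀ j u → (x⟨ j ⟩ ≟ᵇ a⟨ u ⟩) ≡ false
  x≟ᵇa j u = ≟ᵇ-≢ x≢a

  embed-aa : ∀ w u v → embed d m w a⟨ u ⟩ a⟨ v ⟩ ≡ w u v
  embed-aa w u v rewrite Fin.splitAt-↑ˡ D u m | Fin.splitAt-↑ˡ D v m = refl

  embed-x· : ∀ w j q → embed d m w x⟨ j ⟩ q ≡ false
  embed-x· w j q rewrite Fin.splitAt-↑ʳ D m j = refl

  embed-·x : ∀ w p j → embed d m w p x⟨ j ⟩ ≡ false
  embed-·x w p j with view p
  ... | a-view u rewrite Fin.splitAt-↑ˡ D u m | Fin.splitAt-↑ʳ D m j = refl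
  ... | x-view i = embed-x· w i x⟨ j ⟩

  embed-InSpan : ∀ {l} {S : Fin l → Tensor D} {w : Tensor D} →
                 InSpan S w → InSpan (embed d m ∘ S) (embed d m w)
  embed-InSpan {S = S} {w} (c , w≡) = c , coefficients
    where
    vanishes : ∀ p q → (∀ w′ → embed d m w′ p q ≡ false) →
               embed d m w p q ≡ sumF2 (λ i → c i ∧ embed d m (S i) p q)
    vanishes p q ≡false =
      trans (≡false w) (sym (sumF2-false (λ i → trans (cong (c i ∧_) (≡false (S i))) (∧-zeroʳ (c i)))))
    coefficients : ∀ p q → embed d m w p q ≡ sumF2 (λ i → c i ∧ embed d m (S i) p q)
    coefficients p q with view p | view q
    ... | a-view u | a-view v =
      trans (embed-aa w u v) (trans (w≡ u v) (sumF2-cong (λ i → cong (c i ∧_) (sym (embed-aa (S i) u v)))))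
    ... | a-view u | x-view j = vanishes a⟨ u ⟩ x⟨ j ⟩ (λ w′ → embed-·x w′ a⟨ u ⟩ j)
    ... | x-view j | _ = vanishes x⟨ j ⟩ q (λ w′ → embed-x· w′ j q)

  IsA : Fin n′ → Set
  IsA p = ∃ λ u → p ≡ a⟨ u ⟩

  embed-support : ∀ w p q → embed d m w p q ≡ true → IsA p × IsA q
  embed-support w p q eq with view p | view q
  ... | a-view u | a-view v = (u , refl) , (v , refl)
  ... | a-view u | x-view j = ⊥-elim (true≢false (trans (sym eq) (embed-·x w a⟨ u ⟩ j)))
  ... | x-view j | _ = ⊥-elim (true≢false (trans (sym eq) (embed-x· w j q)))

  Σ²-embed : ∀ (w : Tensor D) (F : Fin n′ → Fin n′ → Bool) →
             Σ² (λ p q → embed d m w p q ∧ F p q) ≡ Σ² (λ u v → w u v ∧ F a⟨ u ⟩ a⟨ v ⟩)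
  Σ²-embed w F = trans (sumF2-++ D m (λ p → sumF2 (λ q → embed d m w p q ∧ F p q)))
    (trans (cong₂ _xor_ (sumF2-cong inner) (sumF2-false xRow)) (xor-identityʳ _))
    where
    inner : ∀ u → sumF2 (λ q → embed d m w a⟨ u ⟩ q ∧ F a⟨ u ⟩ q) ≡ sumF2 (λ v → w u v ∧ F a⟨ u ⟩ a⟨ v ⟩)
    inner u = trans (sumF2-++ D m (λ q → embed d m w a⟨ u ⟩ q ∧ F a⟨ u ⟩ q)) (trans
      (cong₂ _xor_ (sumF2-cong (λ v → cong (_∧ F a⟨ u ⟩ a⟨ v ⟩) (embed-aa w u v)))
                   (sumF2-false (λ j → cong (_∧ F a⟨ u ⟩ x⟨ j ⟩) (embed-·x w a⟨ u ⟩ j))))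
      (xor-identityʳ _))
    xRow : ∀ j → sumF2 (λ q → embed d m w x⟨ j ⟩ q ∧ F x⟨ j ⟩ q) ≡ false
    xRow j = sumF2-false (λ q → cong (_∧ F x⟨ j ⟩ q) (embed-x· w j q))

module TwistedBasis (d m : ℕ) {Ω : List (Tensor (ℕ.suc d))} (N : NormalizedBasis Ω) where

  open Alphabet d m

  data Binomial : Set where
    swapXX  : (p q : Fin m) → q < p → Binomial
    squareX : Fin m → Binomial
    swapXA  : Fin m → Fin D → Binomial

  leadL leadR tailL tailR : Binomial → Fin n′
  leadL (swapXX p q _) = x⟨ p ⟩
  leadL (squareX p) = x⟨ p ⟩
  leadL (swapXA p u) = x⟨ p ⟩
  leadR (swapXX p q _) = x⟨ q ⟩
  leadR (squareX p) = x⟨ p ⟩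
  leadR (swapXA p u) = a⟨ u ⟩
  tailL (swapXX p q _) = x⟨ q ⟩
  tailL (squareX p) = t
  tailL (swapXA p u) = a⟨ u ⟩
  tailR (swapXX p q _) = x⟨ p ⟩
  tailR (squareX p) = x⟨ p ⟩
  tailR (swapXA p u) = x⟨ p ⟩

  binomial : Binomial → Tensor n′
  binomial b = mono (leadL b) (leadR b) ⊕ mono (tailL b) (tailR b)

  tailL<leadL : ∀ b → tailL b < leadL b
  tailL<leadL (swapXX p q q<p) rewrite Fin.toℕ-↑ʳ D q | Fin.toℕ-↑ʳ D p = ℕ.+-monoʳ-< D q<p
  tailL<leadL (squareX p) = a<x zero p
  tailL<leadL (swapXA p u) = a<x u p

  tailL<tailR : ∀ b → tailL b < tailR b
  tailL<tailR (swapXX p q q<p) = tailL<leadL (swapXX p q q<p)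
  tailL<tailR (squareX p) = a<x zero p
  tailL<tailR (swapXA p u) = a<x u p

  leadR≤leadL : ∀ b → leadR b ≤ leadL b
  leadR≤leadL (swapXX p q q<p) = ℕ.<⇒≤ (tailL<leadL (swapXX p q q<p))
  leadR≤leadL (squareX p) = ℕ.≤-refl
  leadR≤leadL (swapXA p u) = ℕ.<⇒≤ (a<x u p)

  leadL≢a : ∀ b {u} → leadL b ≢ a⟨ u ⟩
  leadL≢a (swapXX _ _ _) = x≢a
  leadL≢a (squareX _) = x≢a
  leadL≢a (swapXA _ _) = x≢a

  tailR≢a : ∀ b {u} → tailR b ≢ a⟨ u ⟩
  tailR≢a (swapXX _ _ _) = x≢a
  tailR≢a (squareX _) = x≢a
  tailR≢a (swapXA _ _) = x≢a

  lead-injective : ∀ {b b′} → leadL b ≡ leadL b′ → leadR b ≡ leadR b′ → b ≡ b′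
  lead-injective {swapXX p q q<p} {swapXX p′ q′ q′<p′} eqL eqR
    with refl ← x-injective eqL | refl ← x-injective eqR = cong (swapXX p q) (Fin.<-irrelevant q<p q′<p′)
  lead-injective {swapXX p q q<p} {squareX p′} eqL eqR
    with refl ← x-injective eqL | refl ← x-injective eqR = ⊥-elim (Fin.<-irrefl refl q<p)
  lead-injective {squareX p} {swapXX p′ q′ q′<p′} eqL eqR
    with refl ← x-injective eqL | refl ← x-injective eqR = ⊥-elim (Fin.<-irrefl refl q′<p′)
  lead-injective {squareX p} {squareX p′} eqL _ = cong squareX (x-injective eqL)
  lead-injective {swapXA p u} {swapXA p′ u′} eqL eqR = cong₂ swapXA (x-injective eqL) (a-injective eqR)
  lead-injective {swapXX _ _ _} {swapXA _ _} _ eqR = ⊥-elim (x≢a eqR)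
  lead-injective {squareX _} {swapXA _ _} _ eqR = ⊥-elim (x≢a eqR)
  lead-injective {swapXA _ _} {swapXX _ _ _} _ eqR = ⊥-elim (a≢x eqR)
  lead-injective {swapXA _ _} {squareX _} _ eqR = ⊥-elim (a≢x eqR)

  data RelIndex : Set where
    fromA : Fin (k N) → RelIndex
    binom : Binomial → RelIndex

  relation : RelIndex → Tensor n′
  relation (fromA i) = embed d m (rel N i)
  relation (binom b) = binomial b

  ldL′ ldR′ : RelIndex → Fin n′
  ldL′ (fromA i) = a⟨ ldL N i ⟩
  ldL′ (binom b) = leadL b
  ldR′ (fromA i) = a⟨ ldR N i ⟩
  ldR′ (binom b) = leadR b

  relation-isLead : ∀ r → IsLead (relation r) (ldL′ r) (ldR′ r)
  relation-isLead (binom b) = IsLead-binomial (tailL<leadL b)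
  relation-isLead (fromA i) = trans (embed-aa (rel N i) _ _) (proj₁ (isLead N i)) , bound
    where
    bound : ∀ p q → relation (fromA i) p q ≡ true → (p , q) ≤lex (ldL′ (fromA i) , ldR′ (fromA i))
    bound p q eq with embed-support (rel N i) p q eq
    ... | (u , refl) , (v , refl) with proj₂ (isLead N i) u v (trans (sym (embed-aa (rel N i) u v)) eq)
    ... | inj₁ u<ld = inj₁ (a-<⁺ u<ld)
    ... | inj₂ (refl , v≤ld) = inj₂ (refl , a-≤⁺ v≤ld)

  -- Tails are never leading monomials: a tail ends in some x⟨ j ⟩ with a smaller
  -- first letter, while a leading monomial ends in an a⟨ u ⟩ or in a letter not
  -- exceeding its first one.
  lead≢tail : ∀ r b → ldL′ r ≡ tailL b → ldR′ r ≢ tailR b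
  lead≢tail (fromA i) (swapXX _ _ _) _ = a≢x
  lead≢tail (fromA i) (squareX _) _ = a≢x
  lead≢tail (fromA i) (swapXA _ _) _ = a≢x
  lead≢tail (binom b) b′ eqL eqR = ℕ.<⇒≱ (subst₂ _<_ (sym eqL) (sym eqR) (tailL<tailR b′)) (leadR≤leadL b)

  relation-at-lead : ∀ r r′ → relation r′ (ldL′ r) (ldR′ r) ≡ true → r ≡ r′
  relation-at-lead r (fromA j) eq with embed-support (rel N j) (ldL′ r) (ldR′ r) eq
  relation-at-lead (binom b) (fromA j) eq | (u , eqL) , _ = ⊥-elim (leadL≢a b eqL)
  relation-at-lead (fromA i) (fromA j) eq | _ with i ≟ j
  ... | yes refl = refl
  ... | no i≢j = ⊥-elim (true≢false (trans (sym eq) (trans (embed-aa (rel N j) _ _) (alone N i j i≢j))))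
  relation-at-lead r (binom b′) eq with binomial⇒≡ {a = leadL b′} {leadR b′} {tailL b′} {tailR b′} {ldL′ r} {ldR′ r} eq
  ... | inj₂ (eqL , eqR) = ⊥-elim (lead≢tail r b′ eqL eqR)
  relation-at-lead (fromA i) (binom b′) eq | inj₁ (eqL , _) = ⊥-elim (leadL≢a b′ (sym eqL))
  relation-at-lead (binom b) (binom b′) eq | inj₁ (eqL , eqR) = cong binom (lead-injective eqL eqR)

  K′ : ℕ
  K′ = k N + (triangle m + (m + m * D))

  swapBelow : Fin (triangle m) → Binomial
  swapBelow i = swapXX (proj₁ (pairBelow i)) (proj₂ (pairBelow i)) (pairBelow-< i)

  swapXA-at : Fin (m * D) → Binomial
  swapXA-at c = uncurry swapXA (remQuot {m} D c)

  decodeBinomial : Fin (triangle m + (m + m * D)) → Binomial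
  decodeBinomial i = [ swapBelow , (λ j → [ squareX , swapXA-at ]′ (splitAt m j)) ]′ (splitAt (triangle m) i)

  decode : Fin K′ → RelIndex
  decode i = [ fromA , binom ∘ decodeBinomial ]′ (splitAt (k N) i)

  decode-injective : ∀ {i j} → decode i ≡ decode j → i ≡ j
  decode-injective = [,]∘splitAt-injective fromA (binom ∘ decodeBinomial)
    (λ { refl → refl }) (binomial-injective ∘ binom-injective) (λ _ _ ())
    where
    binom-injective : ∀ {b b′} → binom b ≡ binom b′ → b ≡ b′
    binom-injective refl = refl
    pair-injective : ∀ {i j} → swapBelow i ≡ swapBelow j → i ≡ j
    pair-injective eq = pairBelow-injective
      (cong₂ _,_ (x-injective (cong leadL eq)) (x-injective (cong leadR eq)))
    swapXA-injective : ∀ {c c′} → swapXA-at c ≡ swapXA-at c′ → c ≡ c′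
    swapXA-injective {c} {c′} eq = begin
      c                                   ≡⟨ Fin.combine-remQuot {m} D c ⟨
      uncurry combine (remQuot {m} D c)   ≡⟨ cong₂ combine (x-injective (cong leadL eq)) (a-injective (cong leadR eq)) ⟩
      uncurry combine (remQuot {m} D c′)  ≡⟨ Fin.combine-remQuot {m} D c′ ⟩
      c′                                  ∎
      where open ≡-Reasoning
    swapBelow≢ : ∀ i j → swapBelow i ≢ [ squareX , swapXA-at ]′ (splitAt m j)
    swapBelow≢ i j eq with splitAt m j
    swapBelow≢ i j () | inj₁ _
    swapBelow≢ i j () | inj₂ _
    binomial-injective : ∀ {i j} → decodeBinomial i ≡ decodeBinomial j → i ≡ j
    binomial-injective = [,]∘splitAt-injective swapBelow _ pair-injective
      ([,]∘splitAt-injective squareX swapXA-at (x-injective ∘ cong leadL) swapXA-injective (λ _ _ ()))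
      swapBelow≢

  decodeBinomial-surjective : ∀ b → ∃ λ i → decodeBinomial i ≡ b
  decodeBinomial-surjective (swapXX p q q<p) with pairBelow-surjective p q q<p
  ... | i , eq = i ↑ˡ _ , trans (cong [ swapBelow , _ ]′ (Fin.splitAt-↑ˡ (triangle m) i _))
                                 (lead-injective (cong (x⟨_⟩ ∘ proj₁) eq) (cong (x⟨_⟩ ∘ proj₂) eq))
  decodeBinomial-surjective (squareX p) = triangle m ↑ʳ (p ↑ˡ _) ,
    trans (cong [ swapBelow , _ ]′ (Fin.splitAt-↑ʳ (triangle m) _ _))
          (cong [ squareX , swapXA-at ]′ (Fin.splitAt-↑ˡ m p _))
  decodeBinomial-surjective (swapXA p u) = triangle m ↑ʳ (m ↑ʳ combine p u) ,
    trans (cong [ swapBelow , _ ]′ (Fin.splitAt-↑ʳ (triangle m) _ _))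
          (trans (cong [ squareX , swapXA-at ]′ (Fin.splitAt-↑ʳ m _ (combine p u)))
                 (cong (uncurry swapXA) (Fin.remQuot-combine p u)))

  decode-surjective : ∀ r → ∃ λ i → decode i ≡ r
  decode-surjective (fromA i) = i ↑ˡ _ , cong [ fromA , _ ]′ (Fin.splitAt-↑ˡ (k N) i _)
  decode-surjective (binom b) with decodeBinomial-surjective b
  ... | i , eq = k N ↑ʳ i , trans (cong [ fromA , _ ]′ (Fin.splitAt-↑ʳ (k N) _ i)) (cong binom eq)

  relation′ : Fin K′ → Tensor n′
  relation′ = relation ∘ decode

  private
    Lold Lxx Lxa : List (Tensor n′)
    Lold = map (embed d m) Ω
    Lxx = concatMap (λ i → map (λ j → mono x⟨ i ⟩ x⟨ j ⟩ ⊕ mono x⟨ j ⟩ x⟨ i ⟩) (allFin m)) (allFin m)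
    Lxa = concatMap (λ j → map (λ u → mono x⟨ j ⟩ a⟨ u ⟩ ⊕ mono a⟨ u ⟩ x⟨ j ⟩) (allFin D)) (allFin m)

  relation-InSpan : ∀ r → InSpan (lookup (twistedRelators d m Ω)) (relation r)
  relation-InSpan (fromA i) =
    InSpan-trans (λ l → ∈⇒InSpan (∈-++⁺ˡ (∈-map⁺ (embed d m) (∈-lookup {xs = Ω} l)))) (embed-InSpan (inΩ N i))
  relation-InSpan (binom (swapXX p q _)) =
    ∈⇒InSpan (∈-++⁺ʳ Lold (∈-++⁺ˡ (∈-pairs⁺ (λ i j → mono x⟨ i ⟩ x⟨ j ⟩ ⊕ mono x⟨ j ⟩ x⟨ i ⟩) p q)))
  relation-InSpan (binom (swapXA p u)) =
    ∈⇒InSpan (∈-++⁺ʳ Lold (∈-++⁺ʳ Lxx (∈-++⁺ˡ (∈-pairs⁺ (λ j u → mono x⟨ j ⟩ a⟨ u ⟩ ⊕ mono a⟨ u ⟩ x⟨ j ⟩) p u))))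
  relation-InSpan (binom (squareX p)) =
    ∈⇒InSpan (∈-++⁺ʳ Lold (∈-++⁺ʳ Lxx (∈-++⁺ʳ Lxa (∈-map⁺ (λ j → mono x⟨ j ⟩ x⟨ j ⟩ ⊕ mono t x⟨ j ⟩) (∈-allFin p)))))

  relation∈span : ∀ r → InSpan relation′ (relation r)
  relation∈span r with decode-surjective r
  ... | i , refl = InSpan-generator relation′ i

  swapXX∈span : ∀ i j → InSpan relation′ (mono x⟨ i ⟩ x⟨ j ⟩ ⊕ mono x⟨ j ⟩ x⟨ i ⟩)
  swapXX∈span i j with Fin.<-cmp i j
  ... | tri< i<j _ _ =
    InSpan-cong (λ p q → xor-comm (mono x⟨ j ⟩ x⟨ i ⟩ p q) _) (relation∈span (binom (swapXX j i i<j)))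
  ... | tri≈ _ refl _ = InSpan-zero relation′ (λ p q → xor-same (mono x⟨ i ⟩ x⟨ i ⟩ p q))
  ... | tri> _ _ j<i = relation∈span (binom (swapXX i j j<i))

  twistedRelator-InSpan : ∀ {w} → w ∈ twistedRelators d m Ω → InSpan relation′ w
  twistedRelator-InSpan w∈ with ∈-++⁻ Lold w∈
  ... | inj₁ w∈old with ∈-map⁻ (embed d m) w∈old
  ...   | ω , ω∈Ω , refl = InSpan-cong (λ p q → cong (λ v → embed d m v p q) (sym (lookup-index ω∈Ω)))
                             (InSpan-trans (relation∈span ∘ fromA) (embed-InSpan (spansΩ N (Any.index ω∈Ω))))
  twistedRelator-InSpan w∈ | inj₂ w∈′ with ∈-++⁻ Lxx w∈′
  ... | inj₁ w∈xx with ∈-pairs⁻ (λ i j → mono x⟨ i ⟩ x⟨ j ⟩ ⊕ mono x⟨ j ⟩ x⟨ i ⟩) w∈xx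
  ...   | i , j , refl = swapXX∈span i j
  twistedRelator-InSpan w∈ | inj₂ w∈′ | inj₂ w∈″ with ∈-++⁻ Lxa w∈″
  ... | inj₁ w∈xa with ∈-pairs⁻ (λ j u → mono x⟨ j ⟩ a⟨ u ⟩ ⊕ mono a⟨ u ⟩ x⟨ j ⟩) w∈xa
  ...   | j , u , refl = relation∈span (binom (swapXA j u))
  twistedRelator-InSpan w∈ | inj₂ w∈′ | inj₂ w∈″ | inj₂ w∈sq
    with ∈-map⁻ (λ j → mono x⟨ j ⟩ x⟨ j ⟩ ⊕ mono t x⟨ j ⟩) w∈sq
  ... | j , _ , refl = relation∈span (binom (squareX j))

  twistedBasis : NormalizedBasis (twistedRelators d m Ω)
  twistedBasis = record
    { k = K′
    ; rel = relation′
    ; ldL = ldL′ ∘ decode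
    ; ldR = ldR′ ∘ decode
    ; isLead = relation-isLead ∘ decode
    ; alone = λ i j i≢j → ¬-not (λ eq → i≢j (decode-injective (relation-at-lead (decode i) (decode j) eq)))
    ; inΩ = relation-InSpan ∘ decode
    ; spansΩ = twistedRelator-InSpan ∘ ∈-lookup
    }

  relation-lead : ∀ r → IsLeadMono twistedBasis (ldL′ r) (ldR′ r)
  relation-lead r with decode-surjective r
  ... | i , refl = i , refl , refl

  lead-aa : ∀ {u v} → IsLeadMono N u v → IsLeadMono twistedBasis a⟨ u ⟩ a⟨ v ⟩
  lead-aa (l , refl , refl) = relation-lead (fromA l)

  lead-aa⁻ : ∀ {u v} → IsLeadMono twistedBasis a⟨ u ⟩ a⟨ v ⟩ → IsLeadMono N u v
  lead-aa⁻ (i , eqL , eqR) with decode i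
  ... | fromA l = l , a-injective eqL , a-injective eqR
  ... | binom b = ⊥-elim (leadL≢a b eqL)

  lead-xa : ∀ p u → IsLeadMono twistedBasis x⟨ p ⟩ a⟨ u ⟩
  lead-xa p u = relation-lead (binom (swapXA p u))

  lead-xx : ∀ p q → q ≤ p → IsLeadMono twistedBasis x⟨ p ⟩ x⟨ q ⟩
  lead-xx p q q≤p with ℕ.m≤n⇒m<n∨m≡n q≤p
  ... | inj₁ q<p = relation-lead (binom (swapXX p q q<p))
  ... | inj₂ q≡p with refl ← Fin.toℕ-injective q≡p = relation-lead (binom (squareX p))

  relation-aa : ∀ r {u v} → relation r a⟨ u ⟩ a⟨ v ⟩ ≡ true → IsA (ldL′ r) × IsA (ldR′ r)
  relation-aa (fromA l) _ = (ldL N l , refl) , (ldR N l , refl)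
  relation-aa (binom b) {u} {v} eq with binomial⇒≡ {a = leadL b} {leadR b} {tailL b} {tailR b} {a⟨ u ⟩} {a⟨ v ⟩} eq
  ... | inj₁ (eqL , _) = ⊥-elim (leadL≢a b (sym eqL))
  ... | inj₂ (_ , eqR) = ⊥-elim (tailR≢a b (sym eqR))

-- Compares the tails first, so that lists of different lengths are unequal by computation.
_≐_ : ∀ {n} → List (Fin n) → List (Fin n) → Bool
[] ≐ [] = true
(a ∷ as) ≐ (b ∷ bs) = (as ≐ bs) ∧ (a ≟ᵇ b)
_ ≐ _ = false

module Invariant (d m : ℕ) {Ω : List (Tensor (ℕ.suc d))} (commutative : GradedCommutative Ω)
                 (N : NormalizedBasis Ω) where

  open Alphabet d m
  open TwistedBasis d m N
  open NormalForm N
  open SortedSupport m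

  data Letter : Set where
    old : Fin D → Letter
    new : Fin m → Letter

  letter : Fin n′ → Letter
  letter p = [ old , new ]′ (splitAt D p)

  letter-a : ∀ u → letter a⟨ u ⟩ ≡ old u
  letter-a u = cong [ old , new ]′ (Fin.splitAt-↑ˡ D u m)

  letter-x : ∀ j → letter x⟨ j ⟩ ≡ new j
  letter-x j = cong [ old , new ]′ (Fin.splitAt-↑ʳ D m j)

  -- Modulo the relations x a = a x, x x′ = x′ x and x x = t x, a monomial becomes
  -- a word in A times a product of distinct x's; its shape records both.
  Shape : Set
  Shape = List (Fin m) × List (Fin D)

  -- The factors t produced by squares x x = t x are put in front of the word in A;
  -- since A is commutative this only matters up to coeffA-swap.
  prependT : ℕ → List (Fin D) → List (Fin D)
  prependT ℕ.zero A = A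
  prependT (ℕ.suc k) A = prependT k (zero ∷ A)

  shapeWith : List (Fin m) × ℕ → List (Fin D) → Shape
  shapeWith (S , k) A = S , prependT k A

  xs⁺ : Letter → List (Fin m) → List (Fin m)
  xs⁺ (old _) S = S
  xs⁺ (new j) S = insert j S

  as⁺ : Letter → List (Fin D) → List (Fin D)
  as⁺ (old u) A = u ∷ A
  as⁺ (new _) A = A

  shape : Letter → Letter → Letter → Shape
  shape l₁ l₂ l₃ = shapeWith (collapse (xs⁺ l₁ (xs⁺ l₂ (xs⁺ l₃ [])))) (as⁺ l₁ (as⁺ l₂ (as⁺ l₃ [])))

  shape-squareˡ : ∀ p l → shape (new p) (new p) l ≡ shape (old zero) (new p) l
  shape-squareˡ p l = cong (λ C → shapeWith C (as⁺ l [])) (collapse-square p (xs⁺ l []))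

  shape-squareʳ : ∀ q p → shape (new q) (new p) (new p) ≡ shape (new q) (old zero) (new p)
  shape-squareʳ q p = cong (λ C → shapeWith C []) (begin
    collapse (insert q (insert p (insert p [])))
      ≡⟨ cong collapse (trans (insert-comm q p (insert p [])) (cong (insert p) (insert-comm q p []))) ⟩
    collapse (insert p (insert p (insert q [])))
      ≡⟨ collapse-square p (insert q []) ⟩
    withT (collapse (insert p (insert q [])))
      ≡⟨ cong (withT ∘ collapse) (insert-comm p q []) ⟩
    withT (collapse (insert q (insert p []))) ∎)
    where open ≡-Reasoning

  coeffA : List (Fin D) → List (Fin D) → Bool
  coeffA (u ∷ v ∷ []) (p ∷ q ∷ []) = nf u v (mono p q)
  coeffA A A′ = A′ ≐ A

  -- coeff K K′ is the coefficient of the normal monomial of shape K in the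
  -- normal form of a monomial of shape K′.
  coeff : Shape → Shape → Bool
  coeff (S , A) (S′ , A′) = (S′ ≐ S) ∧ coeffA A A′

  coeffAt : Shape → Cube n′
  coeffAt K p q r = coeff K (shape (letter p) (letter q) (letter r))

  Λ : Shape → Cube n′ → Bool
  Λ K f = Σ³ (λ p q r → f p q r ∧ coeffAt K p q r)

  Λ-xor : ∀ K {f f′ g : Cube n′} → (∀ p q r → f′ p q r ≡ f p q r xor g p q r) → Λ K f′ ≡ Λ K f xor Λ K g
  Λ-xor K {f} {f′} {g} f′≡ = trans
    (Σ³-cong (λ p q r → trans (cong (_∧ coeffAt K p q r) (f′≡ p q r))
                              (∧-distribʳ-xor (coeffAt K p q r) (f p q r) (g p q r))))
    (Σ³-xor (λ p q r → f p q r ∧ coeffAt K p q r) (λ p q r → g p q r ∧ coeffAt K p q r))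

  coeffA-swap : ∀ A a b → coeffA A (a ∷ b ∷ []) ≡ coeffA A (b ∷ a ∷ [])
  coeffA-swap [] a b = refl
  coeffA-swap (u ∷ []) a b = refl
  coeffA-swap (u ∷ v ∷ []) a b = nf-comm commutative u v a b
  coeffA-swap (u ∷ v ∷ w ∷ A) a b = refl

  coeffA-annihilates : ∀ A l → Σ² (λ u v → rel N l u v ∧ coeffA A (u ∷ v ∷ [])) ≡ false
  coeffA-annihilates (a ∷ b ∷ []) l = trans (nf-expand a b (rel N l)) (nf-rel a b l)
  coeffA-annihilates [] l = Σ²-false (λ u v → ∧-zeroʳ (rel N l u v))
  coeffA-annihilates (a ∷ []) l = Σ²-false (λ u v → ∧-zeroʳ (rel N l u v))
  coeffA-annihilates (a ∷ b ∷ c ∷ A) l = Σ²-false (λ u v → ∧-zeroʳ (rel N l u v))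

  coeffAt-binomialˡ : ∀ K b c → coeffAt K (leadL b) (leadR b) c ≡ coeffAt K (tailL b) (tailR b) c
  coeffAt-binomialˡ K (swapXX p q _) c rewrite letter-x p | letter-x q =
    cong (λ S → coeff K (shapeWith (collapse S) (as⁺ (letter c) []))) (insert-comm p q (xs⁺ (letter c) []))
  coeffAt-binomialˡ K (squareX p) c rewrite letter-x p | letter-a zero = cong (coeff K) (shape-squareˡ p (letter c))
  coeffAt-binomialˡ K (swapXA p u) c rewrite letter-x p | letter-a u = refl

  coeffAt-binomialʳ : ∀ K b a → coeffAt K a (leadL b) (leadR b) ≡ coeffAt K a (tailL b) (tailR b)
  coeffAt-binomialʳ K (swapXX p q _) a rewrite letter-x p | letter-x q =
    cong (λ S → coeff K (shapeWith (collapse (xs⁺ (letter a) S)) (as⁺ (letter a) []))) (insert-comm p q [])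
  coeffAt-binomialʳ K (swapXA p u) a rewrite letter-x p | letter-a u = refl
  coeffAt-binomialʳ K (squareX p) a with letter a
  ... | new q rewrite letter-x p | letter-a zero = cong (coeff K) (shape-squareʳ q p)
  ... | old w rewrite letter-x p | letter-a zero | collapse-square p [] =
    cong (((p ∷ []) ≐ proj₁ K) ∧_) (coeffA-swap (proj₂ K) zero w)

  module _ (s : Fin m) (S : List (Fin m)) (A : List (Fin D)) where

    private
      K : Shape
      K = s ∷ S , A

    coeffAt-aaa : ∀ u v w → coeffAt K a⟨ u ⟩ a⟨ v ⟩ a⟨ w ⟩ ≡ false
    coeffAt-aaa u v w rewrite letter-a u | letter-a v | letter-a w = refl

    coeffAt-aax : ∀ u v j → coeffAt K a⟨ u ⟩ a⟨ v ⟩ x⟨ j ⟩ ≡ ((j ∷ []) ≐ (s ∷ S)) ∧ coeffA A (u ∷ v ∷ [])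
    coeffAt-aax u v j rewrite letter-a u | letter-a v | letter-x j = refl

    coeffAt-xaa : ∀ j u v → coeffAt K x⟨ j ⟩ a⟨ u ⟩ a⟨ v ⟩ ≡ ((j ∷ []) ≐ (s ∷ S)) ∧ coeffA A (u ∷ v ∷ [])
    coeffAt-xaa j u v rewrite letter-a u | letter-a v | letter-x j = refl

    coeffA-annihilates-∧ˡ : ∀ l B → Σ² (λ u v → rel N l u v ∧ (B ∧ coeffA A (u ∷ v ∷ []))) ≡ false
    coeffA-annihilates-∧ˡ l B = begin
      Σ² (λ u v → rel N l u v ∧ (B ∧ coeffA A (u ∷ v ∷ [])))
        ≡⟨ Σ²-cong (λ u v → ∧-swapˡ (rel N l u v) B (coeffA A (u ∷ v ∷ []))) ⟩
      Σ² (λ u v → B ∧ (rel N l u v ∧ coeffA A (u ∷ v ∷ [])))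
        ≡⟨ Σ²-∧ˡ B (λ u v → rel N l u v ∧ coeffA A (u ∷ v ∷ [])) ⟩
      B ∧ Σ² (λ u v → rel N l u v ∧ coeffA A (u ∷ v ∷ []))
        ≡⟨ cong (B ∧_) (coeffA-annihilates A l) ⟩
      B ∧ false
        ≡⟨ ∧-zeroʳ B ⟩
      false ∎
      where open ≡-Reasoning

    relation-annihilatedˡ : ∀ r c → Σ² (λ p q → relation r p q ∧ coeffAt K p q c) ≡ false
    relation-annihilatedˡ (binom b) c =
      trans (Σ²-binomial (λ p q → coeffAt K p q c) (leadL b) (leadR b) (tailL b) (tailR b))
            (≡⇒xor≡false (coeffAt-binomialˡ K b c))
    relation-annihilatedˡ (fromA l) c with view c
    ... | a-view w = trans (Σ²-embed (rel N l) (λ p q → coeffAt K p q a⟨ w ⟩))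
                           (Σ²-false (λ u v → trans (cong (rel N l u v ∧_) (coeffAt-aaa u v w)) (∧-zeroʳ _)))
    ... | x-view j = trans (Σ²-embed (rel N l) (λ p q → coeffAt K p q x⟨ j ⟩))
                           (trans (Σ²-cong (λ u v → cong (rel N l u v ∧_) (coeffAt-aax u v j)))
                                  (coeffA-annihilates-∧ˡ l _))

    relation-annihilatedʳ : ∀ r a → Σ² (λ q r′ → relation r q r′ ∧ coeffAt K a q r′) ≡ false
    relation-annihilatedʳ (binom b) a =
      trans (Σ²-binomial (coeffAt K a) (leadL b) (leadR b) (tailL b) (tailR b))
            (≡⇒xor≡false (coeffAt-binomialʳ K b a))
    relation-annihilatedʳ (fromA l) a with view a
    ... | a-view w = trans (Σ²-embed (rel N l) (coeffAt K a⟨ w ⟩))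
                           (Σ²-false (λ u v → trans (cong (rel N l u v ∧_) (coeffAt-aaa w u v)) (∧-zeroʳ _)))
    ... | x-view j = trans (Σ²-embed (rel N l) (coeffAt K x⟨ j ⟩))
                           (trans (Σ²-cong (λ u v → cong (rel N l u v ∧_) (coeffAt-xaa j u v)))
                                  (coeffA-annihilates-∧ˡ l _))

    Λ-step : ∀ {f f′} → Step twistedBasis f f′ → Λ K f′ ≡ Λ K f
    Λ-step {f} (left i c _ f′≡) = trans (Λ-xor K {f} {g = λ p q r → relation′ i p q ∧ (r ≟ᵇ c)} f′≡) (trans
      (cong (Λ K f xor_) (trans (Σ³-selectʳ (relation′ i) c (coeffAt K)) (relation-annihilatedˡ (decode i) c)))
      (xor-identityʳ _))
    Λ-step {f} (right i a _ f′≡) = trans (Λ-xor K {f} {g = λ p q r → (p ≟ᵇ a) ∧ relation′ i q r} f′≡) (trans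
      (cong (Λ K f xor_) (trans (Σ³-selectˡ (relation′ i) a (coeffAt K)) (relation-annihilatedʳ (decode i) a)))
      (xor-identityʳ _))

    Λ-reduces : ∀ {f f′} → Reduces twistedBasis f f′ → Λ K f′ ≡ Λ K f
    Λ-reduces ε = refl
    Λ-reduces (step ◅ steps) = trans (Λ-reduces steps) (Λ-step step)

module MixedConfluence (d m : ℕ) {Ω : List (Tensor (ℕ.suc d))} (commutative : GradedCommutative Ω)
                       (N : NormalizedBasis Ω) where

  open Alphabet d m
  open TwistedBasis d m N
  open NormalForm N
  open SortedSupport m
  open Invariant d m commutative N

  NoAAA : Cube n′ → Set
  NoAAA f = ∀ u v w → f a⟨ u ⟩ a⟨ v ⟩ a⟨ w ⟩ ≡ false

  NoAAA-step : ∀ {f f′} → NoAAA f → Step twistedBasis f f′ → NoAAA f′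
  NoAAA-step {f} noAAA (left i c lead∈f f′≡) u v w =
    trans (f′≡ _ _ _) (trans (cong (_xor _) (noAAA u v w)) (¬-not new-term))
    where
    new-term : relation′ i a⟨ u ⟩ a⟨ v ⟩ ∧ (a⟨ w ⟩ ≟ᵇ c) ≢ true
    new-term eq with ∧≡true eq
    ... | rel≡ , c≡ with relation-aa (decode i) rel≡ | ≟ᵇ⇒≡ {x = a⟨ w ⟩} {c} c≡
    ... | (u′ , eqL) , (v′ , eqR) | refl =
      true≢false (trans (sym (subst₂ (λ p q → f p q a⟨ w ⟩ ≡ true) eqL eqR lead∈f)) (noAAA u′ v′ w))
  NoAAA-step {f} noAAA (right i a lead∈f f′≡) u v w =
    trans (f′≡ _ _ _) (trans (cong (_xor _) (noAAA u v w)) (¬-not new-term))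
    where
    new-term : (a⟨ u ⟩ ≟ᵇ a) ∧ relation′ i a⟨ v ⟩ a⟨ w ⟩ ≢ true
    new-term eq with ∧≡true eq
    ... | a≡ , rel≡ with relation-aa (decode i) rel≡ | ≟ᵇ⇒≡ {x = a⟨ u ⟩} {a} a≡
    ... | (v′ , eqL) , (w′ , eqR) | refl =
      true≢false (trans (sym (subst₂ (λ q r → f a⟨ u ⟩ q r ≡ true) eqL eqR lead∈f)) (noAAA u v′ w′))

  NoAAA-reduces : ∀ {f f′} → Reduces twistedBasis f f′ → NoAAA f → NoAAA f′
  NoAAA-reduces ε noAAA = noAAA
  NoAAA-reduces (step ◅ steps) noAAA = NoAAA-reduces steps (NoAAA-step noAAA step)

  data MixedNormal : Set where
    aax : (u v : Fin D) (j : Fin m) → ¬ IsLeadMono N u v → MixedNormal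
    axx : (u : Fin D) (i j : Fin m) → i < j → MixedNormal
    xxx : (i j k : Fin m) → i < j → j < k → MixedNormal

  at₁ at₂ at₃ : MixedNormal → Fin n′
  at₁ (aax u v j _) = a⟨ u ⟩
  at₁ (axx u i j _) = a⟨ u ⟩
  at₁ (xxx i j k _ _) = x⟨ i ⟩
  at₂ (aax u v j _) = a⟨ v ⟩
  at₂ (axx u i j _) = x⟨ i ⟩
  at₂ (xxx i j k _ _) = x⟨ j ⟩
  at₃ (aax u v j _) = x⟨ j ⟩
  at₃ (axx u i j _) = x⟨ j ⟩
  at₃ (xxx i j k _ _) = x⟨ k ⟩

  supportHead : MixedNormal → Fin m
  supportHead (aax u v j _) = j
  supportHead (axx u i j _) = i
  supportHead (xxx i j k _ _) = i

  supportTail : MixedNormal → List (Fin m)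
  supportTail (aax u v j _) = []
  supportTail (axx u i j _) = j ∷ []
  supportTail (xxx i j k _ _) = j ∷ k ∷ []

  word : MixedNormal → List (Fin D)
  word (aax u v j _) = u ∷ v ∷ []
  word (axx u i j _) = u ∷ []
  word (xxx i j k _ _) = []

  shapeOf : MixedNormal → Shape
  shapeOf Q = supportHead Q ∷ supportTail Q , word Q

  coeffAt-shapeOf : ∀ K Q → coeffAt K (at₁ Q) (at₂ Q) (at₃ Q) ≡ coeff K (shapeOf Q)
  coeffAt-shapeOf K (aax u v j _) rewrite letter-a u | letter-a v | letter-x j = refl
  coeffAt-shapeOf K (axx u i j i<j) rewrite letter-a u | letter-x i | letter-x j =
    cong (λ C → coeff K (shapeWith C (u ∷ []))) (collapse-increasing₂ i<j)
  coeffAt-shapeOf K (xxx i j k i<j j<k) rewrite letter-x i | letter-x j | letter-x k =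
    cong (λ C → coeff K (shapeWith C [])) (collapse-increasing₃ i<j j<k)

  coeff-normal : ∀ Q Q′ → coeff (shapeOf Q) (shapeOf Q′) ≡ mono3 (at₁ Q) (at₂ Q) (at₃ Q) (at₁ Q′) (at₂ Q′) (at₃ Q′)
  coeff-normal (aax u v j _) (aax u′ v′ j′ ¬lead) rewrite a≟ᵇa u′ u | a≟ᵇa v′ v | x≟ᵇx j′ j | nf-normal u v ¬lead =
    ∧-comm (j′ ≟ᵇ j) _
  coeff-normal (aax u v j _) (axx u′ i′ j′ _) rewrite x≟ᵇa i′ v | ∧-zeroʳ (a⟨ u′ ⟩ ≟ᵇ a⟨ u ⟩) = refl
  coeff-normal (aax u v j _) (xxx i′ j′ k′ _ _) rewrite x≟ᵇa i′ u = refl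
  coeff-normal (axx u i j _) (aax u′ v′ j′ _) rewrite a≟ᵇx v′ i | ∧-zeroʳ (a⟨ u′ ⟩ ≟ᵇ a⟨ u ⟩) = refl
  coeff-normal (axx u i j _) (axx u′ i′ j′ _) rewrite a≟ᵇa u′ u | x≟ᵇx i′ i | x≟ᵇx j′ j =
    xy∙z≈zy∙x (j′ ≟ᵇ j) (i′ ≟ᵇ i) (u′ ≟ᵇ u)
  coeff-normal (axx u i j _) (xxx i′ j′ k′ _ _) rewrite x≟ᵇa i′ u = refl
  coeff-normal (xxx i j k _ _) (aax u′ v′ j′ _) rewrite a≟ᵇx u′ i = refl
  coeff-normal (xxx i j k _ _) (axx u′ i′ j′ _) rewrite a≟ᵇx u′ i = refl
  coeff-normal (xxx i j k _ _) (xxx i′ j′ k′ _ _) rewrite x≟ᵇx i′ i | x≟ᵇx j′ j | x≟ᵇx k′ k =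
    trans (∧-identityʳ _) (xy∙z≈zy∙x (k′ ≟ᵇ k) (j′ ≟ᵇ j) (i′ ≟ᵇ i))

  normal-xx⇒< : ∀ {i j} → ¬ IsLeadMono twistedBasis x⟨ i ⟩ x⟨ j ⟩ → i < j
  normal-xx⇒< {i} {j} ¬lead = ℕ.≰⇒> (λ j≤i → ¬lead (lead-xx i j j≤i))

  classify : ∀ {g} → IsNormal twistedBasis g → NoAAA g → ∀ p q r → g p q r ≡ true →
             ∃ λ Q → at₁ Q ≡ p × at₂ Q ≡ q × at₃ Q ≡ r
  classify {g} normal noAAA p q r eq with normal p q r eq | view p | view q | view r
  ... | _ | a-view u | a-view v | a-view w = ⊥-elim (true≢false (trans (sym eq) (noAAA u v w)))
  ... | ¬lead₁ , _ | a-view u | a-view v | x-view j = aax u v j (¬lead₁ ∘ lead-aa) , refl , refl , refl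
  ... | _ , ¬lead₂ | a-view u | x-view i | a-view w = ⊥-elim (¬lead₂ (lead-xa i w))
  ... | _ , ¬lead₂ | a-view u | x-view i | x-view j = axx u i j (normal-xx⇒< ¬lead₂) , refl , refl , refl
  ... | ¬lead₁ , _ | x-view i | a-view v | _ = ⊥-elim (¬lead₁ (lead-xa i v))
  ... | _ , ¬lead₂ | x-view i | x-view j | a-view w = ⊥-elim (¬lead₂ (lead-xa j w))
  ... | ¬lead₁ , ¬lead₂ | x-view i | x-view j | x-view k =
    xxx i j k (normal-xx⇒< ¬lead₁) (normal-xx⇒< ¬lead₂) , refl , refl , refl

  Λ-normal : ∀ {g} → IsNormal twistedBasis g → NoAAA g → ∀ Q → Λ (shapeOf Q) g ≡ g (at₁ Q) (at₂ Q) (at₃ Q)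
  Λ-normal {g} normal noAAA Q = trans (Σ³-cong term) (Σ³-mono3ʳ g (at₁ Q) (at₂ Q) (at₃ Q))
    where
    term : ∀ p q r → g p q r ∧ coeffAt (shapeOf Q) p q r ≡ g p q r ∧ mono3 (at₁ Q) (at₂ Q) (at₃ Q) p q r
    term p q r with g p q r in eq
    ... | false = refl
    ... | true with classify normal noAAA p q r eq
    ... | Q′ , refl , refl , refl = trans (coeffAt-shapeOf (shapeOf Q) Q′) (coeff-normal Q Q′)

  normal-forms-agree : ∀ {f g h} → NoAAA f → Reduces twistedBasis f g → Reduces twistedBasis f h →
                       IsNormal twistedBasis g → IsNormal twistedBasis h → ∀ p q r → g p q r ≡ true → h p q r ≡ true
  normal-forms-agree {f} {g} {h} noAAA f↠g f↠h normal-g normal-h p q r eq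
    with classify normal-g (NoAAA-reduces f↠g noAAA) p q r eq
  ... | Q , refl , refl , refl = begin
    h (at₁ Q) (at₂ Q) (at₃ Q)  ≡⟨ Λ-normal normal-h (NoAAA-reduces f↠h noAAA) Q ⟨
    Λ (shapeOf Q) h            ≡⟨ Λ-reduces (supportHead Q) (supportTail Q) (word Q) f↠h ⟩
    Λ (shapeOf Q) f            ≡⟨ Λ-reduces (supportHead Q) (supportTail Q) (word Q) f↠g ⟨
    Λ (shapeOf Q) g            ≡⟨ Λ-normal normal-g (NoAAA-reduces f↠g noAAA) Q ⟩
    g (at₁ Q) (at₂ Q) (at₃ Q)  ≡⟨ eq ⟩
    true                       ∎
    where open ≡-Reasoning

  mixed-confluent : ∀ a b c → NoAAA (mono3 a b c) → Confluent twistedBasis a b c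
  mixed-confluent a b c noAAA g h ↠g ↠h normal-g normal-h p q r = ≡true⇔⇒≡
    (normal-forms-agree noAAA ↠g ↠h normal-g normal-h p q r)
    (normal-forms-agree noAAA ↠h ↠g normal-h normal-g p q r)

  mono3-NoAAA : ∀ {a b c} → ¬ (IsA a × IsA b × IsA c) → NoAAA (mono3 a b c)
  mono3-NoAAA {a} {b} {c} ¬AAA u v w = ¬-not contra
    where
    contra : mono3 a b c a⟨ u ⟩ a⟨ v ⟩ a⟨ w ⟩ ≢ true
    contra eq with ∧≡true eq
    ... | uv≡ , w≡ with ∧≡true uv≡
    ... | u≡ , v≡ = ¬AAA ((u , sym (≟ᵇ⇒≡ u≡)) , (v , sym (≟ᵇ⇒≡ v≡)) , (w , sym (≟ᵇ⇒≡ w≡)))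

module OldConfluence (d m : ℕ) {Ω : List (Tensor (ℕ.suc d))} (N : NormalizedBasis Ω) where

  open Alphabet d m
  open TwistedBasis d m N

  InA : Cube n′ → Set
  InA f = ∀ p q r → f p q r ≡ true → IsA p × IsA q × IsA r

  restrict : Cube n′ → Cube D
  restrict f u v w = f a⟨ u ⟩ a⟨ v ⟩ a⟨ w ⟩

  -- The source of the restricted step is any F pointwise equal to restrict f, since
  -- restrict (mono3 a⟨ a ⟩ a⟨ b ⟩ a⟨ c ⟩) is only pointwise equal to mono3 a b c.
  module _ {f f′ : Cube n′} (inA : InA f) (F : Cube D) (F≗f : ∀ u v w → F u v w ≡ restrict f u v w) where

    restrict-stepˡ : ∀ r c → f (ldL′ r) (ldR′ r) c ≡ true →
                     (∀ p q s → f′ p q s ≡ f p q s xor (relation r p q ∧ (s ≟ᵇ c))) →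
                     Step N F (restrict f′) × InA f′
    restrict-stepˡ r c lead∈f f′≡ with inA _ _ _ lead∈f
    restrict-stepˡ (binom b) c _ _ | (_ , eqL) , _ = ⊥-elim (leadL≢a b eqL)
    restrict-stepˡ (fromA l) c lead∈f f′≡ | _ , _ , (c′ , refl) =
      left l c′ (trans (F≗f _ _ _) lead∈f) restricted , inA′
      where
      restricted : ∀ u v w → restrict f′ u v w ≡ F u v w xor (rel N l u v ∧ (w ≟ᵇ c′))
      restricted u v w = trans (f′≡ _ _ _)
        (cong₂ _xor_ (sym (F≗f u v w)) (cong₂ _∧_ (embed-aa (rel N l) u v) (a≟ᵇa w c′)))
      inA′ : InA f′
      inA′ p q s eq with xor≡true (trans (sym (f′≡ p q s)) eq)
      ... | inj₁ in-f = inA p q s in-f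
      ... | inj₂ new with ∧≡true new
      ... | in-rel , s≡c with embed-support (rel N l) p q in-rel
      ... | Ap , Aq = Ap , Aq , (c′ , ≟ᵇ⇒≡ {x = s} s≡c)

    restrict-stepʳ : ∀ r a → f a (ldL′ r) (ldR′ r) ≡ true →
                     (∀ p q s → f′ p q s ≡ f p q s xor ((p ≟ᵇ a) ∧ relation r q s)) →
                     Step N F (restrict f′) × InA f′
    restrict-stepʳ r a lead∈f f′≡ with inA _ _ _ lead∈f
    restrict-stepʳ (binom b) a _ _ | _ , (_ , eqL) , _ = ⊥-elim (leadL≢a b eqL)
    restrict-stepʳ (fromA l) a lead∈f f′≡ | (a′ , refl) , _ =
      right l a′ (trans (F≗f _ _ _) lead∈f) restricted , inA′
      where
      restricted : ∀ u v w → restrict f′ u v w ≡ F u v w xor ((u ≟ᵇ a′) ∧ rel N l v w)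
      restricted u v w = trans (f′≡ _ _ _)
        (cong₂ _xor_ (sym (F≗f u v w)) (cong₂ _∧_ (a≟ᵇa u a′) (embed-aa (rel N l) v w)))
      inA′ : InA f′
      inA′ p q s eq with xor≡true (trans (sym (f′≡ p q s)) eq)
      ... | inj₁ in-f = inA p q s in-f
      ... | inj₂ new with ∧≡true new
      ... | p≡a , in-rel with embed-support (rel N l) q s in-rel
      ... | Aq , As = (a′ , ≟ᵇ⇒≡ {x = p} p≡a) , Aq , As

  restrict-step : ∀ {f f′} → InA f → ∀ F → (∀ u v w → F u v w ≡ restrict f u v w) →
                  Step twistedBasis f f′ → Step N F (restrict f′) × InA f′
  restrict-step inA F F≗f (left i c lead∈f f′≡) = restrict-stepˡ inA F F≗f (decode i) c lead∈f f′≡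
  restrict-step inA F F≗f (right i a lead∈f f′≡) = restrict-stepʳ inA F F≗f (decode i) a lead∈f f′≡

  restrict-reduces : ∀ {f f′} → InA f → ∀ F → (∀ u v w → F u v w ≡ restrict f u v w) →
                     Reduces twistedBasis f f′ →
                     ∃ λ G → Reduces N F G × (∀ u v w → G u v w ≡ restrict f′ u v w) × InA f′
  restrict-reduces inA F F≗f ε = F , ε , F≗f , inA
  restrict-reduces inA F F≗f (step ◅ steps) with restrict-step inA F F≗f step
  ... | stepA , inA′ with restrict-reduces inA′ _ (λ _ _ _ → refl) steps
  ... | G , stepsA , G≗ , inA″ = G , stepA ◅ stepsA , G≗ , inA″

  restrict-normal : ∀ {g} {G : Cube D} → IsNormal twistedBasis g → (∀ u v w → G u v w ≡ restrict g u v w) →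
                    IsNormal N G
  restrict-normal normal G≗g u v w eq with normal _ _ _ (trans (sym (G≗g u v w)) eq)
  ... | ¬lead₁ , ¬lead₂ = ¬lead₁ ∘ lead-aa , ¬lead₂ ∘ lead-aa

  mono3-InA : ∀ a b c → InA (mono3 a⟨ a ⟩ a⟨ b ⟩ a⟨ c ⟩)
  mono3-InA a b c p q r eq with ∧≡true eq
  ... | pq≡ , r≡ with ∧≡true pq≡
  ... | p≡ , q≡ = (a , ≟ᵇ⇒≡ {x = p} p≡) , (b , ≟ᵇ⇒≡ {x = q} q≡) , (c , ≟ᵇ⇒≡ {x = r} r≡)

  restrict-mono3 : ∀ a b c u v w → mono3 a b c u v w ≡ restrict (mono3 a⟨ a ⟩ a⟨ b ⟩ a⟨ c ⟩) u v w
  restrict-mono3 a b c u v w = sym (cong₂ _∧_ (cong₂ _∧_ (a≟ᵇa u a) (a≟ᵇa v b)) (a≟ᵇa w c))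

  InA⇒support⊆ : ∀ {g h} → InA g → (∀ u v w → restrict g u v w ≡ restrict h u v w) →
             ∀ p q r → g p q r ≡ true → h p q r ≡ true
  InA⇒support⊆ inA agree p q r eq with inA p q r eq
  ... | (u , refl) , (v , refl) , (w , refl) = trans (sym (agree u v w)) eq

  old-confluent : ∀ a b c → Confluent N a b c → Confluent twistedBasis a⟨ a ⟩ a⟨ b ⟩ a⟨ c ⟩
  old-confluent a b c confluent g h ↠g ↠h normal-g normal-h p q r
    with restrict-reduces (mono3-InA a b c) (mono3 a b c) (restrict-mono3 a b c) ↠g
       | restrict-reduces (mono3-InA a b c) (mono3 a b c) (restrict-mono3 a b c) ↠h
  ... | G , ↠G , G≗g , inA-g | H , ↠H , H≗h , inA-h =
    ≡true⇔⇒≡ (InA⇒support⊆ inA-g agree p q r) (InA⇒support⊆ inA-h (λ u v w → sym (agree u v w)) p q r)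
    where
    agree : ∀ u v w → restrict g u v w ≡ restrict h u v w
    agree u v w = trans (sym (G≗g u v w)) (trans
      (confluent G H ↠G ↠H (restrict-normal normal-g G≗g) (restrict-normal normal-h H≗h) u v w)
      (H≗h u v w))

proposition6p1 : (d m : ℕ) (Ω : List (Tensor (suc d))) →
    GradedCommutative Ω → IsPBW Ω → IsPBW (twistedRelators d m Ω)
proposition6p1 d m Ω commutative (N , confluent) = twistedBasis , critical-confluent
  where
  open Alphabet d m
  open TwistedBasis d m N
  open MixedConfluence d m commutative N
  open OldConfluence d m N

  critical-confluent : ∀ a b c → Critical twistedBasis a b c → Confluent twistedBasis a b c
  critical-confluent a b c (lead₁ , lead₂) with view a | view b | view c
  ... | a-view u | a-view v | a-view w = old-confluent u v w (confluent u v w (lead-aa⁻ lead₁ , lead-aa⁻ lead₂))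
  ... | x-view j | _ | _ = mixed-confluent _ _ _ (mono3-NoAAA λ ((_ , x≡a) , _) → x≢a x≡a)
  ... | a-view _ | x-view j | _ = mixed-confluent _ _ _ (mono3-NoAAA λ (_ , (_ , x≡a) , _) → x≢a x≡a)
  ... | a-view _ | a-view _ | x-view j = mixed-confluent _ _ _ (mono3-NoAAA λ (_ , _ , (_ , x≡a)) → x≢a x≡a)
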